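{- Let $H$ be a finite graph and $\mu(H)$ as in the context. Let $G$ be a subgraph of a Cartesian product $\Gamma=G_1\square\cdots\square G_m$ of finite connected graphs not containing $H$ as a minor, and let $d:=\mathrm{vcd}^*(G)$ (with respect to $\Gamma$). Then $G$ has an orientation in which every vertex has outdegree at most $d\,\mu(H)$.
   Context: All graphs are finite, simple, undirected. The Cartesian product $G_1\square\cdots\square G_m$ has vertex set $V(G_1)\times\cdots\times V(G_m)$, two tuples being adjacent iff they differ in exactly one coordinate $j$ and their $j$-th coordinates are adjacent in $G_j$. $\mu(H)$ is a constant such that every finite graph without $H$ as a minor has average degree $2|E|/|V|$ at most $\mu(H)$. Minor-subproducts: for each $i$, let $\mathcal P_i=\{P^i_1,\ldots,P^i_{t_i}\}$ be a partition of $V(G_i)$ into sets each inducing a connected subgraph of $G_i$, and let $M_i$ be a graph on vertex set $\mathcal P_i$ such that whenever two parts are adjacent in $M_i$ some edge of $G_i$ joins them. Then $M=M_1\square\cdots\square M_m$ is a minor-subproduct of $\Gamma$, shattered by $G$ if every set $P^1_{l_1}\times\cdots\times P^m_{l_m}$ contains a vertex of $G$. A factor is non-trivial if it has at least two vertices. $\mathrm{vcd}^*(G)$ is the largest number of non-trivial factors of a minor-subproduct of $\Gamma$ shattered by $G$.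
   Formalization: The constant μ(H) ranges over the nonnegative rationals. -}

module Defs where

open import Data.Nat using (ℕ; zero; suc; _+_; _*_; _≤_; _≤ᵇ_)
open import Data.Fin using (Fin; zero; suc)
open import Data.Bool using (Bool; true; false; if_then_else_)
open import Data.Maybe using (Maybe; just)
open import Data.Product using (Σ; _×_; _,_; ∃)
open import Data.Sum using (_⊎_)
open import Relation.Nullary using (¬_)
open import Relation.Binary.PropositionalEquality using (_≡_)

countB : (n : ℕ) → (Fin n → Bool) → ℕ
countB zero    f = 0
countB (suc n) f = (if f zero then 1 else 0) + countB n (λ i → f (suc i))

sumF : (n : ℕ) → (Fin n → ℕ) → ℕ
sumF zero    f = 0
sumF (suc n) f = f zero + sumF n (λ i → f (suc i))

record Graph : Set where
  field
    size   : ℕ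
    adj    : Fin size → Fin size → Bool
    sym    : ∀ x y → adj x y ≡ adj y x
    irrefl : ∀ x → adj x x ≡ false
open Graph public

-- degree, and the degree sum 2|E|
deg : (G : Graph) → Fin (size G) → ℕ
deg G x = countB (size G) (adj G x)

degSum : Graph → ℕ
degSum G = sumF (size G) (deg G)

-- reachability by a walk in G whose vertices after the first lie in S
data Reach (G : Graph) (S : Fin (size G) → Set) : Fin (size G) → Fin (size G) → Set where
  here : ∀ {x} → Reach G S x x
  step : ∀ {x y z} → adj G x y ≡ true → S y → Reach G S y z → Reach G S x z

ConnectedSet : (G : Graph) → (Fin (size G) → Set) → Set
ConnectedSet G S = ∀ x y → S x → S y → Reach G S x y

Connected : Graph → Set
Connected G = ∀ (x y : Fin (size G)) → Reach G (λ _ → Fin 1) x y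

-- H is a minor of G: branch sets (f x ≡ just u means x lies in the branch set of u),
-- automatically disjoint, each nonempty and connected, adjacent branch sets for edges of H
Minor : (H G : Graph) → Set
Minor H G =
  Σ (Fin (size G) → Maybe (Fin (size H))) λ f →
    (∀ u → ∃ λ x → f x ≡ just u) ×
    (∀ u → ConnectedSet G (λ x → f x ≡ just u)) ×
    (∀ u v → adj H u v ≡ true →
      Σ (Fin (size G)) λ x → Σ (Fin (size G)) λ y →
        f x ≡ just u × f y ≡ just v × adj G x y ≡ true)

record Orientation (G : Graph) : Set where
  field
    out      : Fin (size G) → Fin (size G) → Bool
    out-edge : ∀ x y → out x y ≡ true → adj G x y ≡ true
    orient   : ∀ x y → adj G x y ≡ true →
                 (out x y ≡ true × out y x ≡ false) ⊎ (out x y ≡ false × out y x ≡ true)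
open Orientation public

outdeg : {G : Graph} → Orientation G → Fin (size G) → ℕ
outdeg {G} o x = countB (size G) (out o x)

ProdV : {m : ℕ} → (Fin m → Graph) → Set
ProdV {m} Gs = (i : Fin m) → Fin (size (Gs i))

ProdAdj : {m : ℕ} (Gs : Fin m → Graph) → ProdV Gs → ProdV Gs → Set
ProdAdj {m} Gs u v =
  Σ (Fin m) λ j → (∀ i → ¬ (i ≡ j) → u i ≡ v i) × adj (Gs j) (u j) (v j) ≡ true

IsSubgraphVia : {m : ℕ} (Gs : Fin m → Graph) (G : Graph) → (Fin (size G) → ProdV Gs) → Set
IsSubgraphVia Gs G φ =
  (∀ x y → (∀ i → φ x i ≡ φ y i) → x ≡ y) ×
  (∀ x y → adj G x y ≡ true → ProdAdj Gs (φ x) (φ y))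

-- minor-subproduct M_1 □ ... □ M_m of the product: part i of G_j is the fiber π j ⁻¹(i)
record MinorSubproduct {m : ℕ} (Gs : Fin m → Graph) : Set where
  field
    t         : Fin m → ℕ
    π         : (j : Fin m) → Fin (size (Gs j)) → Fin (t j)
    π-surj    : ∀ j (a : Fin (t j)) → ∃ λ x → π j x ≡ a
    π-conn    : ∀ j (a : Fin (t j)) → ConnectedSet (Gs j) (λ x → π j x ≡ a)
    Madj      : (j : Fin m) → Fin (t j) → Fin (t j) → Bool
    Madj-sym  : ∀ j a b → Madj j a b ≡ Madj j b a
    Madj-irr  : ∀ j a → Madj j a a ≡ false
    Madj-real : ∀ j a b → Madj j a b ≡ true →
                  Σ (Fin (size (Gs j))) λ x → Σ (Fin (size (Gs j))) λ y →
                    π j x ≡ a × π j y ≡ b × adj (Gs j) x y ≡ true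
open MinorSubproduct public

nontrivial : {m : ℕ} {Gs : Fin m → Graph} → MinorSubproduct Gs → ℕ
nontrivial {m} M = countB m (λ j → 2 ≤ᵇ t M j)

Shattered : {m : ℕ} {Gs : Fin m → Graph} (G : Graph) → (Fin (size G) → ProdV Gs) →
            MinorSubproduct Gs → Set
Shattered {m} G φ M =
  ∀ (l : (j : Fin m) → Fin (t M j)) → Σ (Fin (size G)) λ x → ∀ j → π M j (φ x j) ≡ l j

IsVcdStar : {m : ℕ} (Gs : Fin m → Graph) (G : Graph) → (Fin (size G) → ProdV Gs) → ℕ → Set
IsVcdStar Gs G φ d =
  (Σ (MinorSubproduct Gs) λ M → Shattered G φ M × nontrivial M ≡ d) ×
  (∀ (M : MinorSubproduct Gs) → Shattered G φ M → nontrivial M ≤ d)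

module Submission where

-- Let μ = p/q bound the average degree of H-minor-free graphs, and write c = ⌊p/q⌋.
-- The proof has three ingredients, developed in this order.
--
--  * Hakimi's theorem: a graph has an orientation of maximum outdegree K as soon as
--    every vertex set S spans at most K·|S| edges.  Proved by reversing directed paths
--    from an overloaded vertex to an underloaded one, which strictly lowers the total
--    excess  Σ (outdeg − K).
--  * A Haussler-style shifting argument.  Number the vertices of each connected factor
--    G_j along a spanning tree (every vertex except the root has a smaller-numbered
--    neighbour, its parent).  Repeatedly pushing the last vertex of one factor onto its
--    parent shows, for every S ⊆ V(G) with vcd* at most d,
--        m·|S| ≤ d·|S| + Σ_j (number of j-lines met by S),
--    where a j-line is a class of points agreeing outside coordinate j.  Shattered "cut"
--    configurations produced along the way are turned into genuine minor-subproducts.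
--  * A fibre bound: a j-line meets G in a subgraph of G_j, hence H-minor-free, and an
--    H-minor-free graph on k ≥ 1 vertices has at most c·(k − 1) edges.  Summing over
--    lines and directions and using the shifting inequality gives  2|E(G[S])| ≤ 2dc·|S|.
--
-- Hakimi's theorem with K = d·c then yields the corollary, since d·c·q ≤ d·p.

open import Defs hiding (sym)
open import Data.Nat using (ℕ; zero; suc; _+_; _*_; _≤_; _<_; z≤n; s≤s; _∸_; _≡ᵇ_; pred; _/_; _≤ᵇ_; _<ᵇ_; NonZero)
open import Data.Nat.Properties
open import Data.Nat.DivMod using (m≡m%n+[m/n]*n; m%n<n; m/n*n≤m)
open import Data.Nat.Tactic.RingSolver using (solve)
open import Data.Fin using (Fin; zero; suc; toℕ; fromℕ<)
open import Data.Fin.Properties using (toℕ-injective; toℕ<n; toℕ-fromℕ<; injective⇒≤) renaming (0≢1+n to zero≢suc; suc-injective to fsuc-injective)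
open import Data.Bool using (Bool; true; false; if_then_else_; _∧_; _∨_; not; T)
open import Data.Bool.Properties using (∨-identityʳ; ∧-identityʳ; ∧-zeroʳ)
open import Algebra.Properties.CommutativeSemigroup +-commutativeSemigroup using (interchange)
open import Relation.Binary.PropositionalEquality
open import Relation.Binary.Definitions using (tri<; tri≈; tri>)
open import Data.Product using (Σ; _×_; _,_; ∃; proj₁; proj₂)
open import Data.Sum using (_⊎_; inj₁; inj₂)
open import Relation.Nullary using (¬_; yes; no)
open import Data.Empty using (⊥; ⊥-elim)
open import Data.Unit using (⊤; tt)
open import Data.List using (_∷_; [])
open import Data.Maybe using (Maybe; just; nothing)

t≢f : true ≡ false → ⊥
t≢f ()

ind : Bool → ℕ
ind true = 1
ind false = 0

ind-∧ : ∀ a b → ind (a ∧ b) ≡ ind a * ind b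
ind-∧ true b = sym (+-identityʳ (ind b))
ind-∧ false b = refl

∧-split : ∀ {a b} → (a ∧ b) ≡ true → a ≡ true × b ≡ true
∧-split {true} {true} e = refl , refl

∧-intro : ∀ {a b} → a ≡ true → b ≡ true → (a ∧ b) ≡ true
∧-intro refl refl = refl

∨-elim : ∀ {a b} → (a ∨ b) ≡ true → a ≡ true ⊎ b ≡ true
∨-elim {true} e = inj₁ refl
∨-elim {false} e = inj₂ e

∨-l : ∀ {a} b → a ≡ true → (a ∨ b) ≡ true
∨-l b refl = refl

∨-r : ∀ a {b} → b ≡ true → (a ∨ b) ≡ true
∨-r true e = refl
∨-r false e = e

not-t : ∀ {z} → not z ≡ true → z ≡ false
not-t {false} _ = refl

not-f : ∀ {z} → z ≡ false → not z ≡ true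
not-f refl = refl

bool-ext : ∀ {a b} → (a ≡ true → b ≡ true) → (b ≡ true → a ≡ true) → a ≡ b
bool-ext {true} {true} f g = refl
bool-ext {true} {false} f g = sym (f refl)
bool-ext {false} {true} f g = g refl
bool-ext {false} {false} f g = refl

eqF : ∀ {n} → Fin n → Fin n → Bool
eqF zero zero = true
eqF zero (suc _) = false
eqF (suc _) zero = false
eqF (suc a) (suc b) = eqF a b

eqF-≡ : ∀ {n} {a b : Fin n} → eqF a b ≡ true → a ≡ b
eqF-≡ {a = zero} {zero} e = refl
eqF-≡ {a = suc a} {suc b} e = cong suc (eqF-≡ e)

eqF-refl : ∀ {n} (a : Fin n) → eqF a a ≡ true
eqF-refl zero = refl
eqF-refl (suc a) = eqF-refl a

eqF-≢ : ∀ {n} {a b : Fin n} → ¬ a ≡ b → eqF a b ≡ false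
eqF-≢ {a = a} {b} ne with eqF a b in e
... | true = ⊥-elim (ne (eqF-≡ e))
... | false = refl

eqN : ℕ → ℕ → Bool
eqN = _≡ᵇ_

eqN-≡ : ∀ {a b} → eqN a b ≡ true → a ≡ b
eqN-≡ {a} {b} e = ≡ᵇ⇒≡ a b (subst T (sym e) tt)

eqN-refl : ∀ a → eqN a a ≡ true
eqN-refl zero = refl
eqN-refl (suc a) = eqN-refl a

eqN-≢ : ∀ {a b} → ¬ a ≡ b → eqN a b ≡ false
eqN-≢ {a} {b} ne with eqN a b in e
... | true = ⊥-elim (ne (eqN-≡ e))
... | false = refl

eqN-false : ∀ {a b} → eqN a b ≡ false → ¬ a ≡ b
eqN-false {a} e refl = t≢f (trans (sym (eqN-refl a)) e)

ltb-true : ∀ m n → (m <ᵇ n) ≡ true → m < n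
ltb-true m n e = <ᵇ⇒< m n (subst T (sym e) tt)

ltb-false : ∀ m n → (m <ᵇ n) ≡ false → n ≤ m
ltb-false m n e = ≮⇒≥ (λ m<n → subst T e (<⇒<ᵇ m<n))

ltb-intro : ∀ m n → m < n → (m <ᵇ n) ≡ true
ltb-intro m n lt with m <ᵇ n in e
... | true = refl
... | false = ⊥-elim (<⇒≱ lt (ltb-false m n e))

ltF : ∀ {n} → Fin n → Fin n → Bool
ltF a b = toℕ a <ᵇ toℕ b

sumF-cong : ∀ n {f g : Fin n → ℕ} → (∀ i → f i ≡ g i) → sumF n f ≡ sumF n g
sumF-cong zero e = refl
sumF-cong (suc n) e = cong₂ _+_ (e zero) (sumF-cong n (λ i → e (suc i)))

sumF-mono : ∀ n {f g : Fin n → ℕ} → (∀ i → f i ≤ g i) → sumF n f ≤ sumF n g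
sumF-mono zero e = z≤n
sumF-mono (suc n) e = +-mono-≤ (e zero) (sumF-mono n (λ i → e (suc i)))

sumF-strict : ∀ n (f g : Fin n → ℕ) (v : Fin n) → (∀ i → f i ≤ g i) → f v < g v → sumF n f < sumF n g
sumF-strict (suc n) f g zero le lt = +-mono-<-≤ lt (sumF-mono n (λ i → le (suc i)))
sumF-strict (suc n) f g (suc v) le lt = +-mono-≤-< (le zero) (sumF-strict n _ _ v (λ i → le (suc i)) lt)

sumF-+ : ∀ n (f g : Fin n → ℕ) → sumF n (λ i → f i + g i) ≡ sumF n f + sumF n g
sumF-+ zero f g = refl
sumF-+ (suc n) f g rewrite sumF-+ n (λ i → f (suc i)) (λ i → g (suc i)) = interchange (f zero) (g zero) _ _

sumF-* : ∀ n k (f : Fin n → ℕ) → sumF n (λ i → k * f i) ≡ k * sumF n f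
sumF-* zero k f = sym (*-zeroʳ k)
sumF-* (suc n) k f rewrite sumF-* n k (λ i → f (suc i)) = sym (*-distribˡ-+ k (f zero) _)

sumF-0 : ∀ n → sumF n (λ _ → 0) ≡ 0
sumF-0 zero = refl
sumF-0 (suc n) = sumF-0 n

sumF-const : ∀ n k → sumF n (λ _ → k) ≡ n * k
sumF-const zero k = refl
sumF-const (suc n) k = cong (k +_) (sumF-const n k)

sumF-≥ : ∀ n (f : Fin n → ℕ) i → f i ≤ sumF n f
sumF-≥ (suc n) f zero = m≤m+n _ _
sumF-≥ (suc n) f (suc i) = ≤-trans (sumF-≥ n _ i) (m≤n+m _ _)

sumF-swap : ∀ n m (f : Fin n → Fin m → ℕ) →
  sumF n (λ i → sumF m (λ j → f i j)) ≡ sumF m (λ j → sumF n (λ i → f i j))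
sumF-swap zero m f = sym (sumF-0 m)
sumF-swap (suc n) m f =
  trans (cong (sumF m (f zero) +_) (sumF-swap n m (λ i j → f (suc i) j)))
        (sym (sumF-+ m (f zero) (λ j → sumF n (λ i → f (suc i) j))))

countB-sum : ∀ n (P : Fin n → Bool) → countB n P ≡ sumF n (λ i → ind (P i))
countB-sum zero P = refl
countB-sum (suc n) P with P zero
... | true = cong suc (countB-sum n (λ i → P (suc i)))
... | false = countB-sum n (λ i → P (suc i))

countB-cong : ∀ n {P Q : Fin n → Bool} → (∀ i → P i ≡ Q i) → countB n P ≡ countB n Q
countB-cong n {P} {Q} e = trans (countB-sum n P) (trans (sumF-cong n (λ i → cong ind (e i))) (sym (countB-sum n Q)))

countB-false : ∀ n → countB n (λ _ → false) ≡ 0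
countB-false zero = refl
countB-false (suc n) = countB-false n

countB≤ : ∀ n (P : Fin n → Bool) → countB n P ≤ n
countB≤ zero P = z≤n
countB≤ (suc n) P with P zero
... | true = s≤s (countB≤ n _)
... | false = m≤n⇒m≤1+n (countB≤ n _)

countB-pos : ∀ n (P : Fin n → Bool) x → P x ≡ true → 1 ≤ countB n P
countB-pos (suc n) P zero e rewrite e = s≤s z≤n
countB-pos (suc n) P (suc x) e with P zero
... | true = s≤s z≤n
... | false = countB-pos n _ x e

countB-wit : ∀ n (P : Fin n → Bool) k → countB n P ≡ suc k → Σ (Fin n) λ x → P x ≡ true
countB-wit (suc n) P k e with P zero in p0
... | true = zero , p0
... | false with countB-wit n _ k e
...   | x , px = suc x , px

countB-bump : ∀ n (P Q : Fin n → Bool) (y : Fin n) → (∀ b → ¬ b ≡ y → P b ≡ Q b) →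
  P y ≡ false → Q y ≡ true → countB n Q ≡ suc (countB n P)
countB-bump (suc n) P Q zero h py qy rewrite py | qy =
  cong suc (countB-cong n (λ i → sym (h (suc i) (λ ()))))
countB-bump (suc n) P Q (suc y) h py qy rewrite h zero (λ ()) with Q zero
... | true = cong suc (countB-bump n _ _ y (λ b ne → h (suc b) (λ e → ne (fsuc-injective e))) py qy)
... | false = countB-bump n _ _ y (λ b ne → h (suc b) (λ e → ne (fsuc-injective e))) py qy

countB-miss : ∀ k (P : Fin k → Bool) x → P x ≡ false → suc (countB k P) ≤ k
countB-miss k P x e = subst (_≤ k) (countB-bump k P (λ z → P z ∨ eqF z x) x
    (λ b ne → trans (sym (∨-identityʳ (P b))) (cong (P b ∨_) (sym (eqF-≢ ne)))) e
    (subst (λ v → (v ∨ eqF x x) ≡ true) (sym e) (eqF-refl x)))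
  (countB≤ k _)

countB-full : ∀ n (P : Fin n → Bool) → n ≤ countB n P → ∀ i → P i ≡ true
countB-full (suc n) P le zero with P zero in e
... | true = refl
... | false = ⊥-elim (<-irrefl refl (≤-trans le (countB≤ n _)))
countB-full (suc n) P le (suc i) with P zero
... | true = countB-full n _ (≤-pred le) i
... | false = ⊥-elim (<-irrefl refl (≤-trans le (countB≤ n _)))

countB-single : ∀ n (v : Fin n) → countB n (λ y → eqF y v) ≡ 1
countB-single (suc n) zero = cong suc (countB-sucs n)
  where countB-sucs : ∀ n → countB n (λ (y : Fin n) → eqF (suc y) (Fin.zero {n})) ≡ 0
        countB-sucs zero = refl
        countB-sucs (suc n) = countB-sucs n
countB-single (suc n) (suc v) = countB-single n v

sum-single : ∀ m (j0 : Fin m) c → sumF m (λ j → ind (eqF j j0) * c) ≡ c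
sum-single m j0 c = trans (sumF-cong m (λ j → *-comm (ind (eqF j j0)) c)) (trans (sumF-* m c _)
  (trans (cong (c *_) (trans (sym (countB-sum m (λ j → eqF j j0))) (countB-single m j0))) (*-identityʳ c)))

inj-count : ∀ a b (P : Fin a → Bool) (Q : Fin b → Bool) (g : Fin a → Fin b) →
  (∀ x → P x ≡ true → Q (g x) ≡ true) →
  (∀ x y → P x ≡ true → P y ≡ true → g x ≡ g y → x ≡ y) → countB a P ≤ countB b Q
inj-count zero b P Q g h1 h2 = z≤n
inj-count (suc a) b P Q g h1 h2 with P zero in p0
... | false = inj-count a b (λ i → P (suc i)) Q (λ i → g (suc i)) (λ x → h1 (suc x))
                (λ x y px py e → fsuc-injective (h2 (suc x) (suc y) px py e))
... | true = subst (suc (countB a (λ i → P (suc i))) ≤_) (sym cnt) (s≤s ih)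
  where
  Q' : Fin b → Bool
  Q' z = Q z ∧ not (eqF z (g zero))
  cnt : countB b Q ≡ suc (countB b Q')
  cnt = countB-bump b Q' Q (g zero) (λ z ne → trans (cong (λ t → Q z ∧ not t) (eqF-≢ ne)) (∧-identityʳ (Q z)))
          (trans (cong (λ t → Q (g zero) ∧ not t) (eqF-refl (g zero))) (∧-zeroʳ (Q (g zero)))) (h1 zero p0)
  ih : countB a (λ i → P (suc i)) ≤ countB b Q'
  ih = inj-count a b (λ i → P (suc i)) Q' (λ i → g (suc i)) h1' (λ x y px py e → fsuc-injective (h2 (suc x) (suc y) px py e))
    where
    h1' : ∀ x → P (suc x) ≡ true → Q' (g (suc x)) ≡ true
    h1' x px with eqF (g (suc x)) (g zero) in e
    ... | true = ⊥-elim (zero≢suc (sym (h2 (suc x) zero px p0 (eqF-≡ e))))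
    ... | false rewrite h1 (suc x) px = refl

search : ∀ n (P : Fin n → Bool) → (Σ (Fin n) λ i → P i ≡ true) ⊎ (∀ i → P i ≡ false)
search zero P = inj₂ (λ ())
search (suc n) P with P zero in e
... | true = inj₁ (zero , e)
... | false with search n (λ i → P (suc i))
...   | inj₁ (i , pi) = inj₁ (suc i , pi)
...   | inj₂ h = inj₂ λ { zero → e ; (suc i) → h i }

searchMin : ∀ n (P : Fin n → Bool) →
  (Σ (Fin n) λ i → P i ≡ true × (∀ j → toℕ j < toℕ i → P j ≡ false)) ⊎ (∀ i → P i ≡ false)
searchMin zero P = inj₂ (λ ())
searchMin (suc n) P with P zero in e
... | true = inj₁ (zero , e , λ j ())
... | false with searchMin n (λ i → P (suc i))
...   | inj₁ (i , pi , mn) = inj₁ (suc i , pi , λ { zero _ → e ; (suc j) lt → mn j (≤-pred lt) })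
...   | inj₂ h = inj₂ λ { zero → e ; (suc i) → h i }

anyB : ∀ n → (Fin n → Bool) → Bool
anyB zero P = false
anyB (suc n) P = P zero ∨ anyB n (λ i → P (suc i))

anyB-sound : ∀ n (P : Fin n → Bool) → anyB n P ≡ true → Σ (Fin n) λ i → P i ≡ true
anyB-sound (suc n) P e with P zero in e0
... | true = zero , e0
... | false with anyB-sound n (λ i → P (suc i)) e
...   | i , pi = suc i , pi

anyB-complete : ∀ n (P : Fin n → Bool) i → P i ≡ true → anyB n P ≡ true
anyB-complete (suc n) P zero e rewrite e = refl
anyB-complete (suc n) P (suc i) e with P zero
... | true = refl
... | false = anyB-complete n (λ i → P (suc i)) i e

anyB-false : ∀ n (P : Fin n → Bool) → anyB n P ≡ false → ∀ i → P i ≡ false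
anyB-false n P e i with P i in pi
... | false = refl
... | true = ⊥-elim (t≢f (trans (sym (anyB-complete n P i pi)) e))

allB : ∀ n → (Fin n → Bool) → Bool
allB zero P = true
allB (suc n) P = P zero ∧ allB n (λ i → P (suc i))

allB-sound : ∀ n (P : Fin n → Bool) → allB n P ≡ true → ∀ i → P i ≡ true
allB-sound (suc n) P e zero with P zero
... | true = refl
... | false = e
allB-sound (suc n) P e (suc i) with P zero
... | true = allB-sound n _ e i
... | false = ⊥-elim (t≢f (sym e))

allB-complete : ∀ n (P : Fin n → Bool) → (∀ i → P i ≡ true) → allB n P ≡ true
allB-complete zero P h = refl
allB-complete (suc n) P h rewrite h zero = allB-complete n _ (λ i → h (suc i))

allB-cong : ∀ n (P Q : Fin n → Bool) → (∀ i → P i ≡ Q i) → allB n P ≡ allB n Q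
allB-cong zero P Q h = refl
allB-cong (suc n) P Q h = cong₂ _∧_ (h zero) (allB-cong n _ _ (λ i → h (suc i)))

adj-ne : ∀ (G : Graph) {a b} → adj G a b ≡ true → ¬ a ≡ b
adj-ne G {a} h refl = t≢f (trans (sym h) (irrefl G a))

-- degIn G S = Σ_{x ∈ S} |N(x) ∩ S| = 2·|E(G[S])|, the degree sum of the subgraph induced by S
degIn : (G : Graph) → (Fin (size G) → Bool) → ℕ
degIn G S = sumF (size G) (λ x → ind (S x) * countB (size G) (λ y → S y ∧ adj G x y))

enum : ∀ n (C : Fin n → Bool) → Fin (countB n C) → Fin n
enum (suc n) C i with C zero
enum (suc n) C zero | true = zero
enum (suc n) C (suc i) | true = suc (enum n (λ z → C (suc z)) i)
enum (suc n) C i | false = suc (enum n (λ z → C (suc z)) i)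

enum-C : ∀ n (C : Fin n → Bool) i → C (enum n C i) ≡ true
enum-C (suc n) C i with C zero in e
enum-C (suc n) C zero | true = e
enum-C (suc n) C (suc i) | true = enum-C n _ i
enum-C (suc n) C i | false = enum-C n _ i

enum-inj : ∀ n (C : Fin n → Bool) i i' → enum n C i ≡ enum n C i' → i ≡ i'
enum-inj (suc n) C i i' e with C zero
enum-inj (suc n) C zero zero e | true = refl
enum-inj (suc n) C (suc i) (suc i') e | true = cong suc (enum-inj n _ i i' (fsuc-injective e))
enum-inj (suc n) C i i' e | false = enum-inj n _ i i' (fsuc-injective e)

sum-enum : ∀ n (C : Fin n → Bool) (f : Fin n → ℕ) →
  sumF (countB n C) (λ i → f (enum n C i)) ≡ sumF n (λ x → ind (C x) * f x)
sum-enum zero C f = refl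
sum-enum (suc n) C f with C zero
... | true = cong₂ _+_ (sym (+-identityʳ (f zero))) (sum-enum n _ (λ z → f (suc z)))
... | false = sum-enum n _ (λ z → f (suc z))

count-enum : ∀ n (C : Fin n → Bool) (P : Fin n → Bool) →
  countB (countB n C) (λ i → P (enum n C i)) ≡ countB n (λ x → C x ∧ P x)
count-enum n C P = trans (countB-sum (countB n C) (λ i → P (enum n C i))) (trans (sum-enum n C (λ x → ind (P x)))
  (trans (sumF-cong n (λ x → sym (ind-∧ (C x) (P x)))) (sym (countB-sum n _))))

induced : (G : Graph) → (Fin (size G) → Bool) → Graph
induced G C = record
  { size = countB (size G) C
  ; adj = λ i i' → adj G (enum (size G) C i) (enum (size G) C i')
  ; sym = λ i i' → Graph.sym G _ _
  ; irrefl = λ i → irrefl G _ }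

degSum-induced : ∀ G C → degSum (induced G C) ≡ degIn G C
degSum-induced G C = trans (sumF-cong _ (λ i → count-enum (size G) C (adj G (enum (size G) C i))))
  (sum-enum (size G) C (λ x → countB (size G) (λ y → C y ∧ adj G x y)))

countB-suc : ∀ k (P : Fin (suc k) → Bool) → countB (suc k) P ≡ ind (P zero) + countB k (λ y → P (suc y))
countB-suc k P with P zero
... | true = refl
... | false = refl

handshake : ∀ k (a : Fin k → Fin k → Bool) → (∀ x y → a x y ≡ a y x) → (∀ x → a x x ≡ false) →
  Σ ℕ λ t → sumF k (λ x → countB k (a x)) ≡ t + t
handshake zero a s i = 0 , refl
handshake (suc k) a s i with handshake k (λ x y → a (suc x) (suc y)) (λ x y → s (suc x) (suc y)) (λ x → i (suc x))
... | t' , e' = R + t' , eq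
  where
  -- R = degree of vertex 0, which is also its contribution to the other rows
  R = countB k (λ y → a zero (suc y))
  col : sumF k (λ x → ind (a (suc x) zero)) ≡ R
  col = trans (sumF-cong k (λ x → cong ind (s (suc x) zero))) (sym (countB-sum k _))
  eq : sumF (suc k) (λ x → countB (suc k) (a x)) ≡ (R + t') + (R + t')
  eq = begin
    countB (suc k) (a zero) + sumF k (λ x → countB (suc k) (a (suc x)))
      ≡⟨ cong₂ _+_ (trans (countB-suc k (a zero)) (cong (λ b → ind b + R) (i zero)))
                   (trans (sumF-cong k (λ x → countB-suc k (a (suc x)))) (sumF-+ k _ _)) ⟩
    R + (sumF k (λ x → ind (a (suc x) zero)) + sumF k (λ x → countB k (λ y → a (suc x) (suc y))))
      ≡⟨ cong (λ z → R + (z + sumF k (λ x → countB k (λ y → a (suc x) (suc y))))) col ⟩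
    R + (R + sumF k (λ x → countB k (λ y → a (suc x) (suc y))))
      ≡⟨ cong (λ z → R + (R + z)) e' ⟩
    R + (R + (t' + t'))
      ≡⟨ regroup R t' ⟩
    (R + t') + (R + t') ∎
    where
    open ≡-Reasoning
    regroup : ∀ r u → r + (r + (u + u)) ≡ (r + u) + (r + u)
    regroup r u = solve (r ∷ u ∷ [])

degSum≤ : ∀ F → degSum F ≤ size F * (size F ∸ 1)
degSum≤ F = ≤-trans (sumF-mono (size F) (λ x → sub1 (countB-miss (size F) (adj F x) x (irrefl F x))))
                    (≤-reflexive (sumF-const (size F) _))
  where sub1 : ∀ {a b} → suc a ≤ b → a ≤ b ∸ 1
        sub1 {a} {suc b} (s≤s h) = h

Reach-mono : ∀ {G : Graph} {S S' : Fin (size G) → Set} → (∀ y → S y → S' y) → ∀ {x z} → Reach G S x z → Reach G S' x z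
Reach-mono h here = here
Reach-mono h (step a s r) = step a (h _ s) (Reach-mono h r)

Reach-app : ∀ {K : Graph} {S} {x y z} → Reach K S x y → Reach K S y z → Reach K S x z
Reach-app here r = r
Reach-app (step a s r) r' = step a s (Reach-app r r')

Reach-rev : ∀ {K : Graph} {S} {x y} → Reach K S x y → S x → Reach K S y x
Reach-rev here sx = here
Reach-rev {K} (step {x} {y} a sy r) sx = Reach-app (Reach-rev r sy) (step (trans (Graph.sym K y x) a) sx here)

minor-transfer : ∀ (H F G : Graph) (ι : Fin (size F) → Fin (size G)) →
  (∀ a b → ι a ≡ ι b → a ≡ b) → (∀ a b → adj F a b ≡ true → adj G (ι a) (ι b) ≡ true) →
  Minor H F → Minor H G
minor-transfer H F G ι inj hom (f , ne , conn , edg) = f' , ne' , conn' , edg'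
  where
  f' : Fin (size G) → Maybe (Fin (size H))
  f' z with search (size F) (λ a → eqF (ι a) z)
  ... | inj₁ (a , _) = f a
  ... | inj₂ _ = nothing
  f'ι : ∀ a → f' (ι a) ≡ f a
  f'ι a with search (size F) (λ a' → eqF (ι a') (ι a))
  ... | inj₁ (a' , e) = cong f (inj a' a (eqF-≡ e))
  ... | inj₂ h = ⊥-elim (t≢f (trans (sym (eqF-refl (ι a))) (h a)))
  f'-inv : ∀ z u → f' z ≡ just u → Σ (Fin (size F)) λ a → ι a ≡ z × f a ≡ just u
  f'-inv z u e with search (size F) (λ a → eqF (ι a) z)
  ... | inj₁ (a , ea) = a , eqF-≡ ea , e
  f'-inv z u () | inj₂ _
  ne' : ∀ u → ∃ λ z → f' z ≡ just u
  ne' u with ne u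
  ... | a , fa = ι a , trans (f'ι a) fa
  mapR : ∀ u {a b} → Reach F (λ x → f x ≡ just u) a b → Reach G (λ z → f' z ≡ just u) (ι a) (ι b)
  mapR u here = here
  mapR u (step ab fb r) = step (hom _ _ ab) (trans (f'ι _) fb) (mapR u r)
  conn' : ∀ u → ConnectedSet G (λ z → f' z ≡ just u)
  conn' u z1 z2 e1 e2 with f'-inv z1 u e1 | f'-inv z2 u e2
  ... | a1 , refl , fa1 | a2 , refl , fa2 = mapR u (conn u a1 a2 fa1 fa2)
  edg' : ∀ u v → adj H u v ≡ true → Σ (Fin (size G)) λ x → Σ (Fin (size G)) λ y →
           f' x ≡ just u × f' y ≡ just v × adj G x y ≡ true
  edg' u v h with edg u v h
  ... | x , y , fx , fy , a = ι x , ι y , trans (f'ι x) fx , trans (f'ι y) fy , hom x y a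
-- Hakimi's orientation theorem.  Start from any orientation and, while some vertex v
-- has outdegree > K, let R be the set of vertices reachable from v by directed paths.
-- R is closed under out-edges, so its induced degree sum is twice its total outdegree;
-- the hypothesis then forces a vertex w ∈ R of outdegree < K, and reversing a simple
-- path v ⇝ w lowers the total excess Σ (outdeg − K) by one.
module _ (G : Graph) where
  private n = size G

  out-false-rev : (o : Orientation G) → ∀ a b → out o a b ≡ true → out o b a ≡ false
  out-false-rev o a b h with orient o a b (out-edge o a b h)
  ... | inj₁ (_ , r) = r
  ... | inj₂ (f , _) = ⊥-elim (t≢f (trans (sym h) f))

  flipOut : (o : Orientation G) (x y : Fin n) → Fin n → Fin n → Bool
  flipOut o x y a b = if eqF a x ∧ eqF b y then false else (if eqF a y ∧ eqF b x then true else out o a b)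

  fo-xy : ∀ o x y → flipOut o x y x y ≡ false
  fo-xy o x y rewrite eqF-refl x | eqF-refl y = refl

  fo-yx : ∀ o x y → ¬ x ≡ y → flipOut o x y y x ≡ true
  fo-yx o x y ne rewrite eqF-≢ (λ e → ne (sym e)) | eqF-refl x | eqF-refl y = refl

  fo-other : ∀ o x y a b → ¬ (a ≡ x × b ≡ y) → ¬ (a ≡ y × b ≡ x) → flipOut o x y a b ≡ out o a b
  fo-other o x y a b n1 n2 with eqF a x in e1 | eqF b y in e2 | eqF a y in e3 | eqF b x in e4
  ... | true | true | _ | _ = ⊥-elim (n1 (eqF-≡ e1 , eqF-≡ e2))
  ... | true | false | true | true = ⊥-elim (n2 (eqF-≡ e3 , eqF-≡ e4))
  ... | true | false | true | false = refl
  ... | true | false | false | _ = refl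
  ... | false | _ | true | true = ⊥-elim (n2 (eqF-≡ e3 , eqF-≡ e4))
  ... | false | _ | true | false = refl
  ... | false | _ | false | _ = refl

  reverseEdge : (o : Orientation G) (x y : Fin n) → out o x y ≡ true → Orientation G
  reverseEdge o x y h = record { out = flipOut o x y ; out-edge = oe ; orient = or }
    where
    xy : ¬ x ≡ y
    xy = adj-ne G (out-edge o x y h)
    oe : ∀ a b → flipOut o x y a b ≡ true → adj G a b ≡ true
    oe a b e with eqF a x in e1 | eqF b y in e2 | eqF a y in e3 | eqF b x in e4
    ... | true | true | _ | _ = ⊥-elim (t≢f (sym e))
    ... | true | false | true | true = subst₂ (λ u v → adj G u v ≡ true) (sym (eqF-≡ e3)) (sym (eqF-≡ e4)) (trans (Graph.sym G y x) (out-edge o x y h))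
    ... | true | false | true | false = out-edge o a b e
    ... | true | false | false | _ = out-edge o a b e
    ... | false | _ | true | true = subst₂ (λ u v → adj G u v ≡ true) (sym (eqF-≡ e3)) (sym (eqF-≡ e4)) (trans (Graph.sym G y x) (out-edge o x y h))
    ... | false | _ | true | false = out-edge o a b e
    ... | false | _ | false | _ = out-edge o a b e
    or : ∀ a b → adj G a b ≡ true →
         (flipOut o x y a b ≡ true × flipOut o x y b a ≡ false) ⊎ (flipOut o x y a b ≡ false × flipOut o x y b a ≡ true)
    or a b ab with a Data.Fin.≟ x | b Data.Fin.≟ y
    ... | yes refl | yes refl = inj₂ (fo-xy o a b , fo-yx o a b xy)
    ... | yes refl | no b≢y with b Data.Fin.≟ a
    ...   | yes refl = ⊥-elim (adj-ne G ab refl)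
    ...   | no b≢a = subst₂ (λ u v → (u ≡ true × v ≡ false) ⊎ (u ≡ false × v ≡ true))
               (sym (fo-other o a y a b (λ p → b≢y (proj₂ p)) (λ p → xy (proj₁ p))))
               (sym (fo-other o a y b a (λ p → b≢a (proj₁ p)) (λ p → b≢y (proj₁ p))))
               (orient o a b ab)
    or a b ab | no a≢x | _ with a Data.Fin.≟ y | b Data.Fin.≟ x
    ... | yes refl | yes refl = inj₁ (fo-yx o b a xy , fo-xy o b a)
    ... | yes refl | no b≢x =
               subst₂ (λ u v → (u ≡ true × v ≡ false) ⊎ (u ≡ false × v ≡ true))
               (sym (fo-other o x a a b (λ p → a≢x (proj₁ p)) (λ p → b≢x (proj₂ p))))
               (sym (fo-other o x a b a (λ p → b≢x (proj₁ p)) (λ p → adj-ne G ab (sym (proj₁ p)))))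
               (orient o a b ab)
    ... | no a≢y | _ =
               subst₂ (λ u v → (u ≡ true × v ≡ false) ⊎ (u ≡ false × v ≡ true))
               (sym (fo-other o x y a b (λ p → a≢x (proj₁ p)) (λ p → a≢y (proj₁ p))))
               (sym (fo-other o x y b a (λ p → a≢y (proj₂ p)) (λ p → a≢x (proj₂ p))))
               (orient o a b ab)

  reverseEdge-outdeg : ∀ o x y (h : out o x y ≡ true) c →
    outdeg (reverseEdge o x y h) c + ind (eqF c x) ≡ outdeg o c + ind (eqF c y)
  reverseEdge-outdeg o x y h c with c Data.Fin.≟ x | c Data.Fin.≟ y
  ... | yes refl | yes refl = ⊥-elim (adj-ne G (out-edge o c c h) refl)
  ... | yes refl | no c≢y = begin
        outdeg (reverseEdge o c y h) c + ind (eqF c c) ≡⟨ cong (λ z → outdeg (reverseEdge o c y h) c + ind z) (eqF-refl c) ⟩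
        outdeg (reverseEdge o c y h) c + 1 ≡⟨ +-comm _ 1 ⟩
        suc (outdeg (reverseEdge o c y h) c) ≡⟨ sym (countB-bump n _ _ y
          (λ b b≢y → fo-other o c y c b (λ p → b≢y (proj₂ p)) (λ p → c≢y (proj₁ p))) (fo-xy o c y) h) ⟩
        outdeg o c ≡⟨ sym (+-identityʳ _) ⟩
        outdeg o c + 0 ≡⟨ cong (λ z → outdeg o c + ind z) (sym (eqF-≢ c≢y)) ⟩
        outdeg o c + ind (eqF c y) ∎
    where open ≡-Reasoning
  ... | no c≢x | yes refl = begin
        outdeg (reverseEdge o x c h) c + ind (eqF c x) ≡⟨ cong (λ z → outdeg (reverseEdge o x c h) c + ind z) (eqF-≢ c≢x) ⟩
        outdeg (reverseEdge o x c h) c + 0 ≡⟨ +-identityʳ _ ⟩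
        outdeg (reverseEdge o x c h) c ≡⟨ countB-bump n _ _ x
          (λ b b≢x → sym (fo-other o x c c b (λ p → c≢x (proj₁ p)) (λ p → b≢x (proj₂ p))))
          (out-false-rev o x c h) (fo-yx o x c (λ e → c≢x (sym e))) ⟩
        suc (outdeg o c) ≡⟨ +-comm 1 _ ⟩
        outdeg o c + 1 ≡⟨ cong (λ z → outdeg o c + ind z) (sym (eqF-refl c)) ⟩
        outdeg o c + ind (eqF c c) ∎
    where open ≡-Reasoning
  ... | no c≢x | no c≢y = begin
        outdeg (reverseEdge o x y h) c + ind (eqF c x) ≡⟨ cong (λ z → outdeg (reverseEdge o x y h) c + ind z) (eqF-≢ c≢x) ⟩
        outdeg (reverseEdge o x y h) c + 0 ≡⟨ cong (_+ 0) (countB-cong n (λ b → fo-other o x y c b (λ p → c≢x (proj₁ p)) (λ p → c≢y (proj₁ p)))) ⟩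
        outdeg o c + 0 ≡⟨ cong (λ z → outdeg o c + ind z) (sym (eqF-≢ c≢y)) ⟩
        outdeg o c + ind (eqF c y) ∎
    where open ≡-Reasoning

  data OPath (o : Orientation G) (v : Fin n) : Fin n → Set where
    start : OPath o v v
    ext : ∀ {a b} → OPath o v a → out o a b ≡ true → OPath o v b

  inP : ∀ {o v w} → Fin n → OPath o v w → Bool
  inP {v = v} c start = eqF c v
  inP c (ext {b = b} p _) = eqF c b ∨ inP c p

  Simple : ∀ {o v w} → OPath o v w → Set
  Simple start = ⊤
  Simple (ext {b = b} p _) = (inP b p ≡ false) × Simple p

  inP-end : ∀ {o v w} (p : OPath o v w) → inP w p ≡ true
  inP-end {v = v} start = eqF-refl v
  inP-end (ext {b = b} p _) rewrite eqF-refl b = refl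

  Edges : ∀ {o v w} → OPath o v w → Orientation G → Set
  Edges start o1 = ⊤
  Edges (ext {a} {b} p _) o1 = (out o1 a b ≡ true) × Edges p o1

  edges-self : ∀ {o v w} (p : OPath o v w) → Edges p o
  edges-self start = tt
  edges-self (ext p e) = e , edges-self p

  edges-tr : ∀ {o v w} (p : OPath o v w) {o1 o2 : Orientation G} →
       (∀ c d → inP c p ≡ true → inP d p ≡ true → out o1 c d ≡ true → out o2 c d ≡ true) →
       Edges p o1 → Edges p o2
  edges-tr start h _ = tt
  edges-tr (ext {a} {b} p e) h (e1 , es) =
    h a b (∨-r (eqF a b) (inP-end p)) (subst (λ z → (z ∨ inP b p) ≡ true) (sym (eqF-refl b)) refl) e1
    , edges-tr p (λ c d ic id → h c d (∨-r (eqF c b) ic) (∨-r (eqF d b) id)) es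

  reversePath : ∀ {o v w} (p : OPath o v w) → Simple p → (o1 : Orientation G) → Edges p o1 →
     Σ (Orientation G) λ o' → ∀ c → outdeg o' c + ind (eqF c v) ≡ outdeg o1 c + ind (eqF c w)
  reversePath start s o1 _ = o1 , λ c → refl
  reversePath {o} {v} {w} (ext {a} {b} p e) (nb , s) o1 (e1 , es) with reversePath p s (reverseEdge o1 a b e1) (edges-tr p tr-ok es)
    where
    nd : ∀ z → inP z p ≡ true → ¬ z ≡ b
    nd z iz refl = t≢f (trans (sym iz) nb)
    tr-ok : ∀ c d → inP c p ≡ true → inP d p ≡ true → out o1 c d ≡ true → flipOut o1 a b c d ≡ true
    tr-ok c d ic id ocd = trans (fo-other o1 a b c d (λ q → nd d id (proj₂ q)) (λ q → nd c ic (proj₁ q))) ocd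
  ... | o' , eff = o' , λ c → +-cancelʳ-≡ (ind (eqF c a)) _ _ (begin
          outdeg o' c + ind (eqF c v) + ind (eqF c a) ≡⟨ cong (_+ ind (eqF c a)) (eff c) ⟩
          outdeg (reverseEdge o1 a b e1) c + ind (eqF c a) + ind (eqF c a) ≡⟨ cong (_+ ind (eqF c a)) (reverseEdge-outdeg o1 a b e1 c) ⟩
          outdeg o1 c + ind (eqF c b) + ind (eqF c a) ∎)
    where open ≡-Reasoning

  record ReachSet (o : Orientation G) (v : Fin n) : Set where
    field
      R : Fin n → Bool
      Rv : R v ≡ true
      pth : ∀ w → R w ≡ true → Σ (OPath o v w) λ p → Simple p × (∀ c → inP c p ≡ true → R c ≡ true)
  open ReachSet

  reachSet-start : ∀ o v → ReachSet o v
  reachSet-start o v = record { R = λ c → eqF c v ; Rv = eqF-refl v ; pth = pth0 }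
    where
    pth0 : ∀ w → eqF w v ≡ true → Σ (OPath o v w) λ p → Simple p × (∀ c → inP c p ≡ true → eqF c v ≡ true)
    pth0 w e with eqF-≡ {a = w} {b = v} e
    ... | refl = start , tt , λ c ic → ic

  reachSet-extend : ∀ {o v} (st : ReachSet o v) a b → R st a ≡ true → R st b ≡ false → out o a b ≡ true →
    Σ (ReachSet o v) λ st' → countB n (R st') ≡ suc (countB n (R st))
  reachSet-extend {o} {v} st a b ra rb ab = record { R = R' ; Rv = ∨-l (eqF v b) (Rv st) ; pth = pth' } ,
      countB-bump n (R st) R' b (λ c c≢b → sym (trans (cong (R st c ∨_) (eqF-≢ c≢b)) (∨-false (R st c))))
                  rb (∨-r (R st b) (eqF-refl b))
    where
    R' : Fin n → Bool
    R' c = R st c ∨ eqF c b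
    ∨-false : ∀ x → (x ∨ false) ≡ x
    ∨-false true = refl
    ∨-false false = refl
    pth' : ∀ w → R' w ≡ true → Σ (OPath o v w) λ p → Simple p × (∀ c → inP c p ≡ true → R' c ≡ true)
    pth' w e with R st w in rw
    ... | true with pth st w rw
    ...   | p , s , inc = p , s , λ c ic → ∨-l (eqF c b) (inc c ic)
    pth' w e | false with eqF-≡ {a = w} {b = b} e
    ... | refl with pth st a ra
    ...   | p , s , inc = ext p ab , (nb , s) , inc'
      where
      nb : inP b p ≡ false
      nb with inP b p in ib
      ... | true = trans (sym (inc b ib)) rb
      ... | false = refl
      inc' : ∀ c → inP c (ext p ab) ≡ true → R' c ≡ true
      inc' c ic with eqF c b in cb
      ... | true = ∨-r (R st c) refl
      ... | false = ∨-l false (inc c ic)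

  Closed : (o : Orientation G) → (Fin n → Bool) → Set
  Closed o R = ∀ a b → R a ≡ true → out o a b ≡ true → R b ≡ true

  reachClosure : ∀ {o v} (k : ℕ) (st : ReachSet o v) → n ≤ countB n (R st) + k → Σ (ReachSet o v) λ st' → Closed o (R st')
  reachClosure zero st le = st , λ a b _ _ → countB-full n (R st) (subst (n ≤_) (+-identityʳ _) le) b
  reachClosure {o} {v} (suc k) st le with anyB n (λ a → R st a ∧ anyB n (λ b → not (R st b) ∧ out o a b)) in ea
  ... | true with anyB-sound n _ ea
  ...   | a , ha with R st a in ra
  ...     | false = ⊥-elim (t≢f (sym ha))
  ...     | true with anyB-sound n _ ha
  ...       | b , hb with R st b in rb | out o a b in oab
  ...         | false | true with reachSet-extend st a b ra rb oab
  ...           | st' , cnt = reachClosure k st' (subst (n ≤_) (trans (+-suc _ k) (cong (_+ k) (sym cnt))) le)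
  reachClosure {o} {v} (suc k) st le | true | a , ha | true | b , () | true | _
  reachClosure {o} {v} (suc k) st le | true | a , ha | true | b , () | false | false
  reachClosure {o} {v} (suc k) st le | false = st , cl
    where
    cl : Closed o (R st)
    cl a b ra oab with R st b in rb
    ... | true = refl
    ... | false = ⊥-elim (t≢f (trans (sym (anyB-complete n _ a (subst (λ z → (z ∧ anyB n (λ b → not (R st b) ∧ out o a b)) ≡ true) (sym ra)
                     (anyB-complete n (λ b → not (R st b) ∧ out o a b) b (subst₂ (λ x y → (not x ∧ y) ≡ true) (sym rb) (sym oab) refl))))) ea))

  sum-ind-count : ∀ (R : Fin n → Bool) (P : Fin n → Fin n → Bool) →
    sumF n (λ x → ind (R x) * countB n (P x)) ≡ sumF n (λ x → sumF n (λ y → ind (R x) * ind (P x y)))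
  sum-ind-count R P = sumF-cong n (λ x → trans (cong (ind (R x) *_) (countB-sum n (P x))) (sym (sumF-* n (ind (R x)) _)))

  noadj : ∀ (o : Orientation G) a b → adj G a b ≡ false → out o a b ≡ false
  noadj o a b h with out o a b in e
  ... | true = trans (sym (out-edge o a b e)) h
  ... | false = refl

  adj-split : ∀ (o : Orientation G) (R : Fin n → Bool) x y →
    ind (R y ∧ adj G x y) ≡ ind (R y ∧ out o x y) + ind (R y ∧ out o y x)
  adj-split o R x y with adj G x y in axy
  ... | true with orient o x y axy
  ...   | inj₁ (p , q) rewrite p | q with R y
  ...     | true = refl
  ...     | false = refl
  adj-split o R x y | true | inj₂ (p , q) rewrite p | q with R y
  ...     | true = refl
  ...     | false = refl
  adj-split o R x y | false rewrite noadj o x y axy | noadj o y x (trans (Graph.sym G y x) axy) with R y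
  ... | true = refl
  ... | false = refl

  -- in a closed set every edge from R to R is an out-edge of R, and vice versa
  closed-degIn : ∀ (o : Orientation G) (R : Fin n → Bool) → Closed o R →
    degIn G R ≡ sumF n (λ x → ind (R x) * outdeg o x) + sumF n (λ x → ind (R x) * outdeg o x)
  closed-degIn o R cl = begin
    degIn G R ≡⟨ sumF-cong n (λ x → cong (ind (R x) *_) (trans (countB-sum n _) (trans (sumF-cong n (adj-split o R x))
            (trans (sumF-+ n _ _) (cong₂ _+_ (sym (countB-sum n _)) (sym (countB-sum n _))))))) ⟩
    sumF n (λ x → ind (R x) * (countB n (λ y → R y ∧ out o x y) + countB n (λ y → R y ∧ out o y x)))
      ≡⟨ trans (sumF-cong n (λ x → *-distribˡ-+ (ind (R x)) _ _)) (sumF-+ n _ _) ⟩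
    sumF n (λ x → ind (R x) * countB n (λ y → R y ∧ out o x y)) + sumF n (λ x → ind (R x) * countB n (λ y → R y ∧ out o y x))
      ≡⟨ cong₂ _+_ outdeg-sum indeg-sum ⟩
    sumF n (λ x → ind (R x) * outdeg o x) + sumF n (λ x → ind (R x) * outdeg o x) ∎
    where
    open ≡-Reasoning
    outdeg-sum : sumF n (λ x → ind (R x) * countB n (λ y → R y ∧ out o x y)) ≡ sumF n (λ x → ind (R x) * outdeg o x)
    outdeg-sum = sumF-cong n out-stays-in-R
      where
      out-stays-in-R : ∀ x → ind (R x) * countB n (λ y → R y ∧ out o x y) ≡ ind (R x) * outdeg o x
      out-stays-in-R x with R x in rx
      ... | false = refl
      ... | true = cong (λ z → z + 0) (countB-cong n f)
        where f : ∀ y → (R y ∧ out o x y) ≡ out o x y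
              f y with out o x y in e
              ... | true = trans (cong (_∧ true) (cl x y rx e)) refl
              ... | false with R y
              ...   | true = refl
              ...   | false = refl
    indeg-as-outdeg : sumF n (λ x → ind (R x) * countB n (λ y → R y ∧ out o y x)) ≡ sumF n (λ x → ind (R x) * countB n (λ y → R y ∧ out o x y))
    indeg-as-outdeg = begin
      sumF n (λ x → ind (R x) * countB n (λ y → R y ∧ out o y x)) ≡⟨ sum-ind-count R (λ x y → R y ∧ out o y x) ⟩
      sumF n (λ x → sumF n (λ y → ind (R x) * ind (R y ∧ out o y x))) ≡⟨ sumF-swap n n _ ⟩
      sumF n (λ y → sumF n (λ x → ind (R x) * ind (R y ∧ out o y x))) ≡⟨ sumF-cong n (λ y → sumF-cong n (λ x → swap-ends y x)) ⟩
      sumF n (λ y → sumF n (λ x → ind (R y) * ind (R x ∧ out o y x))) ≡⟨ sym (sum-ind-count R (λ y x → R x ∧ out o y x)) ⟩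
      sumF n (λ x → ind (R x) * countB n (λ y → R y ∧ out o x y)) ∎
      where
      swap-ends : ∀ y x → ind (R x) * ind (R y ∧ out o y x) ≡ ind (R y) * ind (R x ∧ out o y x)
      swap-ends y x rewrite ind-∧ (R y) (out o y x) | ind-∧ (R x) (out o y x) =
        trans (sym (*-assoc (ind (R x)) _ _)) (trans (cong (_* ind (out o y x)) (*-comm (ind (R x)) (ind (R y)))) (*-assoc (ind (R y)) _ _))
    indeg-sum : sumF n (λ x → ind (R x) * countB n (λ y → R y ∧ out o y x)) ≡ sumF n (λ x → ind (R x) * outdeg o x)
    indeg-sum = trans indeg-as-outdeg outdeg-sum

  ltF-tot : ∀ (a b : Fin n) → ¬ a ≡ b → ltF a b ≡ not (ltF b a)
  ltF-tot a b ne with ltF a b in e1 | ltF b a in e2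
  ... | true | true = ⊥-elim (<-asym (ltb-true (toℕ a) _ e1) (ltb-true (toℕ b) _ e2))
  ... | true | false = refl
  ... | false | true = refl
  ... | false | false = ⊥-elim (ne (toℕ-injective (≤-antisym (ltb-false (toℕ b) _ e2) (ltb-false (toℕ a) _ e1))))

  initialOrientation : Orientation G
  initialOrientation = record { out = λ a b → adj G a b ∧ ltF a b ; out-edge = oe ; orient = or }
    where
    oe : ∀ a b → (adj G a b ∧ ltF a b) ≡ true → adj G a b ≡ true
    oe a b e with adj G a b
    ... | true = refl
    ... | false = e
    or : ∀ a b → adj G a b ≡ true → ((adj G a b ∧ ltF a b) ≡ true × (adj G b a ∧ ltF b a) ≡ false) ⊎
                                    ((adj G a b ∧ ltF a b) ≡ false × (adj G b a ∧ ltF b a) ≡ true)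
    or a b ab rewrite ab | Graph.sym G b a | ab | ltF-tot a b (adj-ne G ab) with ltF b a
    ... | true = inj₂ (refl , refl)
    ... | false = inj₁ (refl , refl)

  module HakimiProof (K : ℕ) (hyp : ∀ S → degIn G S ≤ 2 * (K * countB n S)) where

    excess : Orientation G → ℕ
    excess o = sumF n (λ c → outdeg o c ∸ K)

    -- a closed set containing an overloaded vertex contains an underloaded one,
    -- otherwise its degree sum would exceed 2K|R|
    closed-overload-impossible : ∀ (o : Orientation G) v (R : Fin n → Bool) → R v ≡ true → Closed o R → K < outdeg o v →
             (∀ w → (R w ∧ (outdeg o w <ᵇ K)) ≡ false) → ⊥
    closed-overload-impossible o v R rv cl kv h = <⇒≱ too-dense (hyp R)
      where
      S = sumF n (λ x → ind (R x) * outdeg o x)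
      termwise : ∀ x → ind (R x) * K + ind (eqF x v) ≤ ind (R x) * outdeg o x
      termwise x with x Data.Fin.≟ v
      ... | yes refl rewrite rv | eqF-refl x | +-identityʳ K | +-identityʳ (outdeg o x) = subst (_≤ outdeg o x) (+-comm 1 K) kv
      ... | no x≢v rewrite eqF-≢ x≢v | +-identityʳ (ind (R x) * K) with R x in rx
      ...   | false = z≤n
      ...   | true rewrite +-identityʳ K | +-identityʳ (outdeg o x) = ltb-false _ _ (subst (λ z → (z ∧ (outdeg o x <ᵇ K)) ≡ false) rx (h x))
      lower : K * countB n R + 1 ≤ S
      lower = subst (_≤ S) eq (sumF-mono n termwise)
        where eq : sumF n (λ x → ind (R x) * K + ind (eqF x v)) ≡ K * countB n R + 1
              eq = trans (sumF-+ n _ _) (cong₂ _+_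
                     (trans (sumF-cong n (λ x → *-comm (ind (R x)) K)) (trans (sumF-* n K _) (cong (K *_) (sym (countB-sum n R)))))
                     (trans (sym (countB-sum n (λ x → eqF x v))) (countB-single n v)))
      two : ∀ a T → a + 1 ≤ T → 2 * a < T + T
      two a T le = subst (_≤ T + T) (cong suc (sym (cong (a +_) (+-identityʳ a))))
                     (+-mono-≤ (subst (_≤ T) (+-comm a 1) le) (≤-trans (m≤m+n a 1) le))
      too-dense : 2 * (K * countB n R) < degIn G R
      too-dense = subst (2 * (K * countB n R) <_) (sym (closed-degIn o R cl)) (two _ S lower)

    descend : ∀ k (o : Orientation G) → excess o < k → Σ (Orientation G) λ o' → ∀ x → outdeg o' x ≤ K
    descend (suc k) o lt with search n (λ v → K <ᵇ outdeg o v)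
    ... | inj₂ h = o , λ x → ltb-false K _ (h x)
    ... | inj₁ (v , hv) with reachClosure n (reachSet-start o v) (m≤n+m n _)
    ...   | st , cl with search n (λ w → ReachSet.R st w ∧ (outdeg o w <ᵇ K))
    ...     | inj₂ h = ⊥-elim (closed-overload-impossible o v (ReachSet.R st) (ReachSet.Rv st) cl (ltb-true K _ hv) h)
    ...     | inj₁ (w , hw) with ReachSet.R st w in rw
    ...       | false = ⊥-elim (t≢f (sym hw))
    ...       | true with ReachSet.pth st w rw
    ...         | p , s , _ with reversePath p s o (edges-self p)
    ...           | o' , eff = descend k o' (≤-trans (sumF-strict n _ _ v excess-nonincreasing excess-drops) (≤-pred lt))
      where
      wK : outdeg o w < K
      wK = ltb-true _ K hw
      vK : K < outdeg o v
      vK = ltb-true K _ hv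
      v≢w : ¬ v ≡ w
      v≢w refl = <-asym wK vK
      excess-nonincreasing : ∀ c → outdeg o' c ∸ K ≤ outdeg o c ∸ K
      excess-nonincreasing c with c Data.Fin.≟ v | c Data.Fin.≟ w
      ... | yes refl | _ = ∸-monoˡ-≤ K (≤-trans (n≤1+n _) (≤-reflexive e))
        where e : suc (outdeg o' c) ≡ outdeg o c
              e = trans (+-comm 1 _) (trans (subst (λ z → outdeg o' c + ind z ≡ outdeg o c + ind (eqF c w)) (eqF-refl c) (eff c))
                    (trans (cong (λ z → outdeg o c + ind z) (eqF-≢ v≢w)) (+-identityʳ _)))
      ... | no _ | yes refl = ≤-trans (≤-reflexive (m≤n⇒m∸n≡0 le)) z≤n
        where le : outdeg o' c ≤ K
              le = ≤-trans (≤-reflexive (trans (sym (+-identityʳ _)) (trans (cong (λ z → outdeg o' c + ind z) (sym (eqF-≢ (λ e → v≢w (sym e)))))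
                     (trans (eff c) (trans (cong (λ z → outdeg o c + ind z) (eqF-refl c)) (+-comm _ 1)))))) wK
      ... | no c≢v | no c≢w = ≤-reflexive (cong (_∸ K) e)
        where e : outdeg o' c ≡ outdeg o c
              e = trans (sym (+-identityʳ _)) (trans (cong (λ z → outdeg o' c + ind z) (sym (eqF-≢ c≢v)))
                    (trans (eff c) (trans (cong (λ z → outdeg o c + ind z) (eqF-≢ c≢w)) (+-identityʳ _))))
      excess-drops : outdeg o' v ∸ K < outdeg o v ∸ K
      excess-drops = ∸-monoˡ-< (≤-reflexive e) (≤-pred (≤-trans vK (≤-reflexive (sym e))))
        where e : suc (outdeg o' v) ≡ outdeg o v
              e = trans (+-comm 1 _) (trans (subst (λ z → outdeg o' v + ind z ≡ outdeg o v + ind (eqF v w)) (eqF-refl v) (eff v))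
                    (trans (cong (λ z → outdeg o v + ind z) (eqF-≢ v≢w)) (+-identityʳ _)))

    bounded-orientation : Σ (Orientation G) λ o → ∀ x → outdeg o x ≤ K
    bounded-orientation = descend (suc (excess initialOrientation)) initialOrientation ≤-refl

hakimi : (G : Graph) (K : ℕ) → (∀ S → degIn G S ≤ 2 * (K * countB (size G) S)) → Σ (Orientation G) λ o → ∀ x → outdeg o x ≤ K
hakimi G K hyp = HakimiProof.bounded-orientation G K hyp

-- For a set S ⊆ Fin N and a relation E (an equivalence on S), the
-- representative of a class is its least element; cl S E counts the representatives,
-- i.e. the number of E-classes met by S.
module Cls (N : ℕ) where
  isRep : (Fin N → Bool) → (Fin N → Fin N → Bool) → Fin N → Bool
  isRep S E x = S x ∧ not (anyB N (λ y → S y ∧ ltF y x ∧ E y x))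

  cl : (Fin N → Bool) → (Fin N → Fin N → Bool) → ℕ
  cl S E = countB N (isRep S E)

  rep-no : ∀ S E x → isRep S E x ≡ true → ∀ y → S y ≡ true → toℕ y < toℕ x → E y x ≡ false
  rep-no S E x r y sy lt with E y x in e
  ... | false = refl
  ... | true with ∧-split {S x} r
  ...   | _ , nr = ⊥-elim (t≢f (trans (sym (anyB-complete N _ y (∧-intro sy (∧-intro (ltb-intro _ _ lt) e)))) (not-t nr)))

  rep-intro : ∀ S E x → S x ≡ true → (∀ y → S y ≡ true → toℕ y < toℕ x → E y x ≡ false) → isRep S E x ≡ true
  rep-intro S E x sx h rewrite sx with anyB N (λ y → S y ∧ ltF y x ∧ E y x) in e
  ... | false = refl
  ... | true with anyB-sound N _ e
  ...   | y , hy with ∧-split {S y} hy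
  ...     | sy , r with ∧-split {ltF y x} r
  ...       | lt , ey = ⊥-elim (t≢f (trans (sym ey) (h y sy (ltb-true _ _ lt))))

  rep-false : ∀ (T : Fin N → Bool) E x → T x ≡ false → isRep T E x ≡ false
  rep-false T E x e rewrite e = refl

  rep-S : ∀ S E x → isRep S E x ≡ true → S x ≡ true
  rep-S S E x r = proj₁ (∧-split {S x} r)

  classMap : ∀ (S1 S2 : Fin N → Bool) (E1 E2 : Fin N → Fin N → Bool) (g : Fin N → Fin N) →
    (∀ x → S1 x ≡ true → E1 x x ≡ true) →
    (∀ x y → E1 x y ≡ true → E1 y x ≡ true) →
    (∀ x y → E2 x y ≡ true → E2 y x ≡ true) →
    (∀ x y z → E2 x y ≡ true → E2 y z ≡ true → E2 x z ≡ true) →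
    (∀ x → S1 x ≡ true → S2 (g x) ≡ true) →
    (∀ x y → S1 x ≡ true → S1 y ≡ true → E1 x y ≡ E2 (g x) (g y)) →
    cl S1 E1 ≤ cl S2 E2
  classMap S1 S2 E1 E2 g r1 s1 s2 t2 gS gE = inj-count N N (isRep S1 E1) (isRep S2 E2) h hrep hinj
    where
    h : Fin N → Fin N
    h x with searchMin N (λ z → S2 z ∧ E2 z (g x))
    ... | inj₁ (z , _) = z
    ... | inj₂ _ = x
    first : ∀ x → S1 x ≡ true → S2 (h x) ≡ true × E2 (h x) (g x) ≡ true × isRep S2 E2 (h x) ≡ true
    first x sx with searchMin N (λ z → S2 z ∧ E2 z (g x))
    ... | inj₂ hh = ⊥-elim (t≢f (trans (sym (∧-intro (gS x sx) (trans (sym (gE x x sx sx)) (r1 x sx)))) (hh (g x))))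
    ... | inj₁ (z , pz , mn) with ∧-split {S2 z} pz
    ...   | sz , ez = sz , ez , rep-intro S2 E2 z sz λ y sy lt → noE y sy lt
      where
      noE : ∀ y → S2 y ≡ true → toℕ y < toℕ z → E2 y z ≡ false
      noE y sy lt with E2 y z in e
      ... | false = refl
      ... | true = ⊥-elim (t≢f (trans (sym (∧-intro sy (t2 y z (g x) e ez))) (mn y lt)))
    hrep : ∀ x → isRep S1 E1 x ≡ true → isRep S2 E2 (h x) ≡ true
    hrep x r = proj₂ (proj₂ (first x (rep-S S1 E1 x r)))
    hinj : ∀ x y → isRep S1 E1 x ≡ true → isRep S1 E1 y ≡ true → h x ≡ h y → x ≡ y
    hinj x y rx ry e = tri
      where
      sx = rep-S S1 E1 x rx
      sy = rep-S S1 E1 y ry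
      e2 : E2 (g x) (g y) ≡ true
      e2 = t2 (g x) (h x) (g y) (s2 _ _ (proj₁ (proj₂ (first x sx))))
             (subst (λ z → E2 z (g y) ≡ true) (sym e) (proj₁ (proj₂ (first y sy))))
      e1 : E1 x y ≡ true
      e1 = trans (gE x y sx sy) e2
      tri : x ≡ y
      tri with Data.Nat.Properties.<-cmp (toℕ x) (toℕ y)
      ... | tri< lt _ _ = ⊥-elim (t≢f (trans (sym e1) (rep-no S1 E1 y ry x sx lt)))
      ... | tri≈ _ eq _ = toℕ-injective eq
      ... | tri> _ _ gt = ⊥-elim (t≢f (trans (sym (s1 x y e1)) (rep-no S1 E1 x rx y sy gt)))

-- Points of ℕ^m (coordinates are vertex ranks in the factors).  Off j u w says that u
-- and w differ at most in coordinate j, i.e. lie on a common j-line; offB decides it.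
module Pts (m : ℕ) where
  Pt : Set
  Pt = Fin m → ℕ

  Off : Fin m → Pt → Pt → Set
  Off j u w = ∀ i → ¬ i ≡ j → u i ≡ w i

  offB : Fin m → Pt → Pt → Bool
  offB j u w = allB m (λ i → eqF i j ∨ eqN (u i) (w i))

  offB-sound : ∀ j u w → offB j u w ≡ true → Off j u w
  offB-sound j u w e i ne with ∨-elim {eqF i j} (allB-sound m _ e i)
  ... | inj₁ x = ⊥-elim (ne (eqF-≡ x))
  ... | inj₂ y = eqN-≡ y

  offB-complete : ∀ j u w → Off j u w → offB j u w ≡ true
  offB-complete j u w h = allB-complete m _ λ i → c i
    where c : ∀ i → (eqF i j ∨ eqN (u i) (w i)) ≡ true
          c i with eqF i j in e
          ... | true = refl
          ... | false = subst (λ z → eqN (u i) z ≡ true) (h i (λ x → t≢f (trans (sym (subst (λ y → eqF i y ≡ true) x (eqF-refl i))) e))) (eqN-refl (u i))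

  offB-refl : ∀ j u → offB j u u ≡ true
  offB-refl j u = offB-complete j u u (λ i _ → refl)

  offB-sym : ∀ j u w → offB j u w ≡ true → offB j w u ≡ true
  offB-sym j u w e = offB-complete j w u (λ i ne → sym (offB-sound j u w e i ne))

  offB-trans : ∀ j u v w → offB j u v ≡ true → offB j v w ≡ true → offB j u w ≡ true
  offB-trans j u v w e1 e2 = offB-complete j u w (λ i ne → trans (offB-sound j u v e1 i ne) (offB-sound j v w e2 i ne))

  offB-cong : ∀ j u u' w w' → Off j u u' → Off j w w' → offB j u w ≡ offB j u' w'
  offB-cong j u u' w w' hu hw = allB-cong m _ _ c
    where c : ∀ i → (eqF i j ∨ eqN (u i) (w i)) ≡ (eqF i j ∨ eqN (u' i) (w' i))
          c i with eqF i j in e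
          ... | true = refl
          ... | false = cong₂ eqN (hu i ne) (hw i ne)
            where ne : ¬ i ≡ j
                  ne x = t≢f (trans (sym (subst (λ y → eqF i y ≡ true) x (eqF-refl i))) e)

  eqAll : Pt → Pt → Bool
  eqAll u w = allB m (λ i → eqN (u i) (w i))

  eqAll-sound : ∀ u w → eqAll u w ≡ true → ∀ i → u i ≡ w i
  eqAll-sound u w e i = eqN-≡ (allB-sound m _ e i)

  eqAll-complete : ∀ u w → (∀ i → u i ≡ w i) → eqAll u w ≡ true
  eqAll-complete u w h = allB-complete m _ (λ i → subst (λ z → eqN (u i) z ≡ true) (h i) (eqN-refl (u i)))

  upd : Pt → Fin m → ℕ → Pt
  upd u j a i = if eqF i j then a else u i

  upd-at : ∀ u j a → upd u j a j ≡ a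
  upd-at u j a rewrite eqF-refl j = refl

  upd-other : ∀ u j a i → ¬ i ≡ j → upd u j a i ≡ u i
  upd-other u j a i ne rewrite eqF-≢ ne = refl

-- Ancestors in rooted trees given by parent functions on ranks, one tree per direction:
-- par j i < i for every non-root rank i ≥ 1.  anc j c v holds when c is an ancestor of v
-- (v itself included).  Cutting at c splits the ranks of factor j into the subtree of c
-- and the rest; these are the two parts of a minor-subproduct factor.
module Anc (m : ℕ) (par : Fin m → ℕ → ℕ) (par< : ∀ j i → 1 ≤ i → par j i < i) where
  -- the ancestor test, with fuel bounding the length of the walk to the root
  ancF : Fin m → ℕ → ℕ → ℕ → Bool
  ancF j c zero v = eqN v c
  ancF j c (suc f) v = eqN v c ∨ (not (eqN v 0) ∧ ancF j c f (par j v))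

  anc : Fin m → ℕ → ℕ → Bool
  anc j c v = ancF j c (suc v) v

  ancF-fuel : ∀ j c f f' v → v < f → v < f' → ancF j c f v ≡ ancF j c f' v
  ancF-fuel j c (suc f) (suc f') zero lt lt' = refl
  ancF-fuel j c (suc f) (suc f') (suc v) lt lt' =
    cong (eqN (suc v) c ∨_) (ancF-fuel j c f f' (par j (suc v))
      (≤-trans (par< j (suc v) (s≤s z≤n)) (≤-pred lt)) (≤-trans (par< j (suc v) (s≤s z≤n)) (≤-pred lt')))

  anc-self : ∀ j c → anc j c c ≡ true
  anc-self j c rewrite eqN-refl c = refl

  anc-step : ∀ j c v → 1 ≤ v → ¬ v ≡ c → anc j c v ≡ anc j c (par j v)
  anc-step j c (suc v) _ ne rewrite eqN-≢ ne =
    ancF-fuel j c (suc v) (suc (par j (suc v))) (par j (suc v)) (par< j (suc v) (s≤s z≤n)) ≤-refl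

  ancF-below : ∀ j c f v → v < f → v < c → ancF j c f v ≡ false
  ancF-below j c (suc f) zero lt lc rewrite eqN-≢ {0} {c} (λ e → <-irrefl e lc) = refl
  ancF-below j c (suc f) (suc v) lt lc rewrite eqN-≢ {suc v} {c} (λ e → <-irrefl e lc) =
    ancF-below j c f (par j (suc v)) (≤-trans (par< j (suc v) (s≤s z≤n)) (≤-pred lt))
      (<-trans (par< j (suc v) (s≤s z≤n)) lc)

  anc-below : ∀ j c v → v < c → anc j c v ≡ false
  anc-below j c v lt = ancF-below j c (suc v) v ≤-refl lt
-- The shifting argument.  A finite family of points is given by S ⊆ Fin N and
-- ψ : Fin N → ℕ^m (injective on S), with coordinate j below nb j.  In direction j the
-- ranks carry the tree of Anc; a cut (J, cut) chooses for each j ∈ J a rank cut j ≥ 1,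
-- splitting direction j into the subtree of cut j and its complement.  DimAtMost S ψ nb d
-- says that every cut shattered by S (all 2^|J| sides occupied) has |J| ≤ d.
module Shifting (m N : ℕ) (par : Fin m → ℕ → ℕ) (par< : ∀ j i → 1 ≤ i → par j i < i) where
  open Pts m
  open Anc m par par<
  open Cls N using (isRep; cl; rep-no; rep-intro; rep-S; rep-false; classMap)

  CutShattered : (Fin N → Bool) → (Fin N → Pt) → (Fin m → Bool) → Pt → Set
  CutShattered S ψ J cut = ∀ (ch : Fin m → Bool) → Σ (Fin N) λ x → S x ≡ true × (∀ j → J j ≡ true → anc j (cut j) (ψ x j) ≡ ch j)

  ValidCut : Pt → (Fin m → Bool) → Pt → Set
  ValidCut nb J cut = ∀ j → J j ≡ true → 1 ≤ cut j × cut j < nb j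

  DimAtMost : (Fin N → Bool) → (Fin N → Pt) → Pt → ℕ → Set
  DimAtMost S ψ nb d = ∀ J cut → ValidCut nb J cut → CutShattered S ψ J cut → countB m J ≤ d

  RanksBelow : (Fin N → Bool) → (Fin N → Pt) → Pt → Set
  RanksBelow S ψ nb = ∀ x → S x ≡ true → ∀ j → ψ x j < nb j

  InjectiveOn : (Fin N → Bool) → (Fin N → Pt) → Set
  InjectiveOn S ψ = ∀ x y → S x ≡ true → S y ≡ true → (∀ j → ψ x j ≡ ψ y j) → x ≡ y

  sameLine : Fin m → (Fin N → Pt) → Fin N → Fin N → Bool
  sameLine j ψ y x = offB j (ψ y) (ψ x)

  lines : Fin m → (Fin N → Bool) → (Fin N → Pt) → ℕ
  lines j S ψ = cl S (sameLine j ψ)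

  -- One compression step in a direction j0 with nb j0 ≥ 2: every point whose j0-rank is
  -- the last one, last = nb j0 − 1, is moved to the parent rank lastPar, unless that
  -- position is already occupied.  The points that cannot move form W ("stuck"); the
  -- family after the step is S' = S − W with positions ψ' and bound nb' = nb[j0 ↦ last].
  module Compress (S : Fin N → Bool) (ψ : Fin N → Pt) (nb : Pt) (j0 : Fin m) (two : 2 ≤ nb j0)
              (bnd : RanksBelow S ψ nb) (inj : InjectiveOn S ψ) where
    last : ℕ
    last = pred (nb j0)
    suc-last : suc last ≡ nb j0
    suc-last = sp (nb j0) two
      where sp : ∀ k → 2 ≤ k → suc (pred k) ≡ k
            sp (suc k) _ = refl
    1≤last : 1 ≤ last
    1≤last = ≤-pred (subst (2 ≤_) (sym suc-last) two)
    lastPar : ℕ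
    lastPar = par j0 last
    lastPar<last : lastPar < last
    lastPar<last = par< j0 last 1≤last
    lastPar≢last : ¬ lastPar ≡ last
    lastPar≢last e = <-irrefl e lastPar<last

    atLast : Fin N → Bool
    atLast x = eqN (ψ x j0) last

    ψ' : Fin N → Pt
    ψ' x = if atLast x then upd (ψ x) j0 lastPar else ψ x

    ψ'-other : ∀ x i → ¬ i ≡ j0 → ψ' x i ≡ ψ x i
    ψ'-other x i ne with atLast x
    ... | true = upd-other (ψ x) j0 lastPar i ne
    ... | false = refl

    ψ'-atLast : ∀ x → atLast x ≡ true → ∀ i → ψ' x i ≡ upd (ψ x) j0 lastPar i
    ψ'-atLast x e i rewrite e = refl

    ψ'-notLast : ∀ x → atLast x ≡ false → ∀ i → ψ' x i ≡ ψ x i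
    ψ'-notLast x e i rewrite e = refl

    Partner : Fin N → Fin N → Set
    Partner x y = S y ≡ true × (∀ i → ψ y i ≡ upd (ψ x) j0 lastPar i)

    hasPartner : Fin N → Bool
    hasPartner x = anyB N (λ y → S y ∧ eqAll (ψ y) (upd (ψ x) j0 lastPar))

    hasPartner-sound : ∀ x → hasPartner x ≡ true → Σ (Fin N) (Partner x)
    hasPartner-sound x e with anyB-sound N _ e
    ... | y , h with ∧-split {S y} h
    ...   | sy , ea = y , sy , eqAll-sound _ _ ea

    hasPartner-complete : ∀ x y → Partner x y → hasPartner x ≡ true
    hasPartner-complete x y (sy , h) = anyB-complete N _ y (∧-intro sy (eqAll-complete _ _ h))

    W : Fin N → Bool
    W x = S x ∧ (atLast x ∧ hasPartner x)

    S' : Fin N → Bool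
    S' x = S x ∧ not (W x)

    -- the compressed family no longer uses the last rank
    nb' : Pt
    nb' = upd nb j0 last

    W-S : ∀ x → W x ≡ true → S x ≡ true
    W-S x e = proj₁ (∧-split {S x} e)
    W-N : ∀ x → W x ≡ true → atLast x ≡ true
    W-N x e = proj₁ (∧-split {atLast x} (proj₂ (∧-split {S x} e)))
    W-part : ∀ x → W x ≡ true → Σ (Fin N) (Partner x)
    W-part x e = hasPartner-sound x (proj₂ (∧-split {atLast x} (proj₂ (∧-split {S x} e))))
    W-intro : ∀ x y → S x ≡ true → atLast x ≡ true → Partner x y → W x ≡ true
    W-intro x y sx nx py = ∧-intro sx (∧-intro nx (hasPartner-complete x y py))

    S'-S : ∀ x → S' x ≡ true → S x ≡ true
    S'-S x e = proj₁ (∧-split {S x} e)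
    S'-W : ∀ x → S' x ≡ true → W x ≡ false
    S'-W x e = not-t (proj₂ (∧-split {S x} e))
    S'-intro : ∀ x → S x ≡ true → W x ≡ false → S' x ≡ true
    S'-intro x sx wx = ∧-intro sx (not-f wx)

    notLast-notW : ∀ x → atLast x ≡ false → W x ≡ false
    notLast-notW x e with W x in w
    ... | false = refl
    ... | true = ⊥-elim (t≢f (trans (sym (W-N x w)) e))

    partner-j0 : ∀ x y → Partner x y → ψ y j0 ≡ lastPar
    partner-j0 x y (_ , h) = trans (h j0) (upd-at (ψ x) j0 lastPar)

    partner-notLast : ∀ x y → Partner x y → atLast y ≡ false
    partner-notLast x y p = eqN-≢ (λ e → lastPar≢last (trans (sym (partner-j0 x y p)) e))

    partner-S' : ∀ x y → Partner x y → S' y ≡ true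
    partner-S' x y p = S'-intro y (proj₁ p) (notLast-notW y (partner-notLast x y p))

    atLast-≡ : ∀ x → atLast x ≡ true → ψ x j0 ≡ last
    atLast-≡ x e = eqN-≡ e

    size-split : countB N S ≡ countB N S' + countB N W
    size-split = trans (countB-sum N S) (trans (sumF-cong N rep-split) (trans (sumF-+ N _ _)
           (cong₂ _+_ (sym (countB-sum N S')) (sym (countB-sum N W)))))
      where
      split-ind : ∀ a c → ind a ≡ ind (a ∧ not (a ∧ c)) + ind (a ∧ c)
      split-ind true true = refl
      split-ind true false = refl
      split-ind false c = refl
      rep-split : ∀ x → ind (S x) ≡ ind (S' x) + ind (W x)
      rep-split x = split-ind (S x) (atLast x ∧ hasPartner x)

    compressed-ranks : RanksBelow S' ψ' nb'
    compressed-ranks x s'x i = ranks-below x (S'-S x s'x) i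
     where
     ranks-below : ∀ x → S x ≡ true → ∀ i → ψ' x i < nb' i
     ranks-below x sx i with i Data.Fin.≟ j0
     ... | no ne = subst₂ _<_ (sym (ψ'-other x i ne)) (sym (upd-other nb j0 last i ne)) (bnd x sx i)
     ... | yes refl with atLast x in nx
     ...   | true = subst₂ _<_ (sym (upd-at (ψ x) i lastPar)) (sym (upd-at nb i last)) lastPar<last
     ...   | false = subst (ψ x i <_) (sym (upd-at nb i last))
                      (≤∧≢⇒< (≤-pred (subst (ψ x i <_) (sym suc-last) (bnd x sx i))) (eqN-false nx))

    -- compression keeps points distinct: a moved point cannot land on an occupied position
    compressed-injective : InjectiveOn S' ψ'
    compressed-injective x y sx sy e = go (atLast x) (atLast y) refl refl
      where
      go : ∀ bx by → atLast x ≡ bx → atLast y ≡ by → x ≡ y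
      go true true nx ny = inj x y (S'-S x sx) (S'-S y sy) h
        where h : ∀ j → ψ x j ≡ ψ y j
              h j with j Data.Fin.≟ j0
              ... | yes refl = trans (atLast-≡ x nx) (sym (atLast-≡ y ny))
              ... | no ne = trans (sym (ψ'-other x j ne)) (trans (e j) (ψ'-other y j ne))
      go false false nx ny = inj x y (S'-S x sx) (S'-S y sy) (λ j → trans (sym (ψ'-notLast x nx j)) (trans (e j) (ψ'-notLast y ny j)))
      go true false nx ny = ⊥-elim (t≢f (trans (sym (W-intro x y (S'-S x sx) nx (S'-S y sy ,
             λ i → sym (trans (sym (ψ'-atLast x nx i)) (trans (e i) (ψ'-notLast y ny i)))))) (S'-W x sx)))
      go false true nx ny = ⊥-elim (t≢f (trans (sym (W-intro y x (S'-S y sy) ny (S'-S x sx ,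
             λ i → trans (sym (ψ'-notLast x nx i)) (trans (e i) (ψ'-atLast y ny i))))) (S'-W y sy)))

    nb'≤nb : ∀ j → nb' j ≤ nb j
    nb'≤nb j with j Data.Fin.≟ j0
    ... | yes refl = subst₂ _≤_ (sym (upd-at nb j last)) suc-last (n≤1+n last)
    ... | no ne = ≤-reflexive (upd-other nb j0 last j ne)

    anc-eq : ∀ x j c → (j ≡ j0 → c < last) → anc j c (ψ' x j) ≡ anc j c (ψ x j)
    anc-eq x j c h with j Data.Fin.≟ j0
    ... | no ne = cong (anc j c) (ψ'-other x j ne)
    ... | yes refl = go (atLast x) refl
      where
      go : ∀ b → atLast x ≡ b → anc j c (ψ' x j) ≡ anc j c (ψ x j)
      go true nx = trans (cong (anc j c) (trans (ψ'-atLast x nx j) (upd-at (ψ x) j lastPar)))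
                     (trans (sym (anc-step j c last 1≤last (λ e → <-irrefl (sym e) (h refl)))) (cong (anc j c) (sym (atLast-≡ x nx))))
      go false nx = cong (anc j c) (ψ'-notLast x nx j)

    compressed-dim : ∀ d → DimAtMost S ψ nb d → DimAtMost S' ψ' nb' d
    compressed-dim d dim J cut val sh = dim J cut val' sh'
      where
      val' : ValidCut nb J cut
      val' j Jj = proj₁ (val j Jj) , ≤-trans (proj₂ (val j Jj)) (nb'≤nb j)
      sh' : CutShattered S ψ J cut
      sh' ch with sh ch
      ... | x , s'x , h = x , S'-S x s'x , λ j Jj → trans (sym (anc-eq x j (cut j)
              (λ { refl → subst (cut j <_) (upd-at nb j last) (proj₂ (val j Jj)) }))) (h j Jj)

    addDir : (Fin m → Bool) → Fin m → Bool
    addDir J i = eqF i j0 ∨ J i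

    -- a cut shattered by the stuck points extends by the cut (j0, last) to a cut
    -- shattered by S: a stuck point realises the side "below last", its partner the other
    lift-stuck-shattering : ∀ J cut → ValidCut nb J cut → CutShattered W ψ J cut →
            (J j0 ≡ false) × ValidCut nb (addDir J) (upd cut j0 last) × CutShattered S ψ (addDir J) (upd cut j0 last)
    lift-stuck-shattering J cut val sh = Jj0 , val' , sh'
      where
      Jj0 : J j0 ≡ false
      Jj0 with J j0 in e
      ... | false = refl
      ... | true with sh (λ _ → not (anc j0 (cut j0) last))
      ...   | x , wx , h = ⊥-elim (notfix (trans (cong (anc j0 (cut j0)) (sym (atLast-≡ x (W-N x wx)))) (h j0 e)))
        where notfix : ∀ {b} → b ≡ not b → ⊥
              notfix {true} ()
              notfix {false} ()
      val' : ValidCut nb (addDir J) (upd cut j0 last)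
      val' j e with j Data.Fin.≟ j0
      ... | yes refl = subst (1 ≤_) (sym (upd-at cut j last)) 1≤last , subst (_< nb j) (sym (upd-at cut j last)) (subst (last <_) suc-last ≤-refl)
      ... | no ne = subst (1 ≤_) (sym (upd-other cut j0 last j ne)) (proj₁ (val j Jj))
                  , subst (_< nb j) (sym (upd-other cut j0 last j ne)) (proj₂ (val j Jj))
        where Jj : J j ≡ true
              Jj = trans (sym (cong (_∨ J j) (eqF-≢ ne))) e
      sh' : CutShattered S ψ (addDir J) (upd cut j0 last)
      sh' ch with sh ch
      ... | x , wx , h = go (ch j0) refl
        where
        go : ∀ b → ch j0 ≡ b → Σ (Fin N) λ z → S z ≡ true × (∀ j → addDir J j ≡ true → anc j (upd cut j0 last j) (ψ z j) ≡ ch j)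
        go true c0 = x , W-S x wx , k
          where k : ∀ j → addDir J j ≡ true → anc j (upd cut j0 last j) (ψ x j) ≡ ch j
                k j e with j Data.Fin.≟ j0
                ... | yes refl = trans (cong₂ (anc j) (upd-at cut j last) (atLast-≡ x (W-N x wx))) (trans (anc-self j last) (sym c0))
                ... | no ne = trans (cong (λ c → anc j c (ψ x j)) (upd-other cut j0 last j ne)) (h j (trans (sym (cong (_∨ J j) (eqF-≢ ne))) e))
        go false c0 with W-part x wx
        ... | y , py = y , proj₁ py , k
          where k : ∀ j → addDir J j ≡ true → anc j (upd cut j0 last j) (ψ y j) ≡ ch j
                k j e with j Data.Fin.≟ j0
                ... | yes refl = trans (cong₂ (anc j) (upd-at cut j last) (partner-j0 x y py)) (trans (anc-below j last lastPar lastPar<last) (sym c0))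
                ... | no ne = trans (cong₂ (anc j) (upd-other cut j0 last j ne) (trans (proj₂ py j) (upd-other (ψ x) j0 lastPar j ne)))
                                    (h j (trans (sym (cong (_∨ J j) (eqF-≢ ne))) e))

    addDir-count : ∀ J → J j0 ≡ false → countB m (addDir J) ≡ suc (countB m J)
    addDir-count J e = countB-bump m J (addDir J) j0 (λ b ne → cong (_∨ J b) (sym (eqF-≢ ne))) e (cong (_∨ J j0) (eqF-refl j0))

    stuck-dim : ∀ d → DimAtMost S ψ nb d → DimAtMost W ψ nb (d ∸ 1)
    stuck-dim d dim J cut val sh with lift-stuck-shattering J cut val sh
    ... | Jj0 , val' , sh' = subst (λ z → z ∸ 1 ≤ d ∸ 1) (addDir-count J Jj0) (∸-monoˡ-≤ 1 (dim _ _ val' sh'))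

    stuck⇒dim≥1 : ∀ d → DimAtMost S ψ nb d → ∀ x → W x ≡ true → 1 ≤ d
    stuck⇒dim≥1 d dim x wx with lift-stuck-shattering (λ _ → false) (λ _ → 0) (λ j ()) (λ ch → x , wx , λ j ())
    ... | Jj0 , val' , sh' = ≤-trans (s≤s z≤n) (subst (_≤ d) (addDir-count (λ _ → false) Jj0) (dim _ _ val' sh'))

    -- stuck points all share their j0-rank, so each lies on its own j0-line
    stuck-lines-j0 : lines j0 W ψ ≡ countB N W
    stuck-lines-j0 = countB-cong N rep-split
      where
      rep-split : ∀ x → isRep W (sameLine j0 ψ) x ≡ W x
      rep-split x = bool-ext (rep-S W (sameLine j0 ψ) x) λ wx → rep-intro W (sameLine j0 ψ) x wx (λ y wy lt → nope y wy lt wx)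
        where
        nope : ∀ y → W y ≡ true → toℕ y < toℕ x → W x ≡ true → sameLine j0 ψ y x ≡ false
        nope y wy lt wx with sameLine j0 ψ y x in e
        ... | false = refl
        ... | true = ⊥-elim (<-irrefl (cong toℕ eqyx) lt)
          where
          eqyx : y ≡ x
          eqyx = inj y x (W-S y wy) (W-S x wx) λ i → h i
            where h : ∀ i → ψ y i ≡ ψ x i
                  h i with i Data.Fin.≟ j0
                  ... | yes refl = trans (atLast-≡ y (W-N y wy)) (sym (atLast-≡ x (W-N x wx)))
                  ... | no ne = offB-sound j0 (ψ y) (ψ x) e i ne

    ψ'-sameLine : ∀ x → Off j0 (ψ' x) (ψ x)
    ψ'-sameLine x i ne = ψ'-other x i ne

    -- every point of S has a point of S' on its j0-line: itself or its partner
    partnerΣ : ∀ x → Σ (Fin N) λ z → S x ≡ true → S' z ≡ true × Off j0 (ψ z) (ψ x)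
    partnerΣ x with W x in wx
    ... | true with W-part x wx
    ...   | y , py = y , λ _ → partner-S' x y py , λ i ne → trans (proj₂ py i) (upd-other (ψ x) j0 lastPar i ne)
    partnerΣ x | false = x , λ sx → S'-intro x sx wx , λ i _ → refl

    partner : Fin N → Fin N
    partner x = proj₁ (partnerΣ x)

    partner-spec : ∀ x → S x ≡ true → S' (partner x) ≡ true × Off j0 (ψ (partner x)) (ψ x)
    partner-spec x sx = proj₂ (partnerΣ x) sx

    compressed-lines-j0 : lines j0 S' ψ' ≡ lines j0 S ψ
    compressed-lines-j0 = ≤-antisym
      (classMap S' S (sameLine j0 ψ') (sameLine j0 ψ) (λ x → x) (λ x _ → offB-refl j0 (ψ' x)) (λ x y → offB-sym j0 (ψ' x) (ψ' y))
        (λ x y → offB-sym j0 (ψ x) (ψ y)) (λ x y z → offB-trans j0 (ψ x) (ψ y) (ψ z)) S'-S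
        (λ x y _ _ → offB-cong j0 (ψ' x) (ψ x) (ψ' y) (ψ y) (ψ'-sameLine x) (ψ'-sameLine y)))
      (classMap S S' (sameLine j0 ψ) (sameLine j0 ψ') partner (λ x _ → offB-refl j0 (ψ x)) (λ x y → offB-sym j0 (ψ x) (ψ y))
        (λ x y → offB-sym j0 (ψ' x) (ψ' y)) (λ x y z → offB-trans j0 (ψ' x) (ψ' y) (ψ' z)) (λ x sx → proj₁ (partner-spec x sx))
        (λ x y sx sy → offB-cong j0 (ψ x) (ψ' (partner x)) (ψ y) (ψ' (partner y))
           (λ i ne → sym (trans (ψ'-sameLine (partner x) i ne) (proj₂ (partner-spec x sx) i ne)))
           (λ i ne → sym (trans (ψ'-sameLine (partner y) i ne) (proj₂ (partner-spec y sy) i ne)))))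

    WS' : ∀ x → W x ≡ true → S' x ≡ false
    WS' x wx with S' x in e
    ... | false = refl
    ... | true = ⊥-elim (t≢f (trans (sym wx) (S'-W x e)))
    S-cases : ∀ x → S x ≡ true → W x ≡ true ⊎ S' x ≡ true
    S-cases x sx with W x in wx
    ... | true = inj₁ refl
    ... | false = inj₂ (∧-intro sx refl)

    -- In a direction j ≠ j0:  lines j S' ψ' + lines j W ψ ≤ lines j S ψ.  The left side
    -- counts classes of the relation Est (j-lines of S' after compression, j-lines of W
    -- before, never related across); a map g : S → S relating x to a point on the
    -- original j-line of ψ' x transfers these classes injectively to j-lines of S.
    module OtherDirection (j : Fin m) (j≢j0 : ¬ j ≡ j0) where
      Est : Fin N → Fin N → Bool
      Est y x = (S' y ∧ (S' x ∧ offB j (ψ' y) (ψ' x))) ∨ (W y ∧ (W x ∧ offB j (ψ y) (ψ x)))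

      ev1 : ∀ a b d c e f → a ≡ true → b ≡ true → d ≡ false → ((a ∧ (b ∧ c)) ∨ (d ∧ (e ∧ f))) ≡ c
      ev1 a b d c e f refl refl refl with c
      ... | true = refl
      ... | false = refl
      ev2 : ∀ a d e b c f → a ≡ false → d ≡ true → e ≡ true → ((a ∧ (b ∧ c)) ∨ (d ∧ (e ∧ f))) ≡ f
      ev2 a d e b c f refl refl refl = refl
      ev3 : ∀ a b d c e f → a ≡ true → b ≡ false → d ≡ false → ((a ∧ (b ∧ c)) ∨ (d ∧ (e ∧ f))) ≡ false
      ev3 a b d c e f refl refl refl = refl
      ev4 : ∀ a d e b c f → a ≡ false → d ≡ true → e ≡ false → ((a ∧ (b ∧ c)) ∨ (d ∧ (e ∧ f))) ≡ false
      ev4 a d e b c f refl refl refl = refl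

      Est-S'S' : ∀ x y → S' x ≡ true → S' y ≡ true → Est x y ≡ offB j (ψ' x) (ψ' y)
      Est-S'S' x y sx sy = ev1 (S' x) (S' y) (W x) (offB j (ψ' x) (ψ' y)) (W y) (offB j (ψ x) (ψ y)) sx sy (S'-W x sx)
      Est-WW : ∀ x y → W x ≡ true → W y ≡ true → Est x y ≡ offB j (ψ x) (ψ y)
      Est-WW x y wx wy = ev2 (S' x) (W x) (W y) (S' y) (offB j (ψ' x) (ψ' y)) (offB j (ψ x) (ψ y)) (WS' x wx) wx wy
      Est-S'W : ∀ x y → S' x ≡ true → W y ≡ true → Est x y ≡ false
      Est-S'W x y sx wy = ev3 (S' x) (S' y) (W x) (offB j (ψ' x) (ψ' y)) (W y) (offB j (ψ x) (ψ y)) sx (WS' y wy) (S'-W x sx)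
      Est-WS' : ∀ x y → W x ≡ true → S' y ≡ true → Est x y ≡ false
      Est-WS' x y wx sy = ev4 (S' x) (W x) (W y) (S' y) (offB j (ψ' x) (ψ' y)) (offB j (ψ x) (ψ y)) (WS' x wx) wx (S'-W y sy)

      -- g x is Good when it lies in S on the j-line of ψ' x; a point at the last rank
      -- whose compressed j-line meets no original point of S is Bad (and g fixes it)
      Good : Fin N → Fin N → Set
      Good x z = S z ≡ true × Off j (ψ z) (ψ' x)
      Bad : Fin N → Set
      Bad x = atLast x ≡ true × (∀ a → S a ≡ true → offB j (ψ a) (ψ' x) ≡ false)

      found : Fin N → Bool
      found x = anyB N (λ a → S a ∧ offB j (ψ a) (ψ' x))

      gΣ : ∀ x → Σ (Fin N) λ z → (S x ≡ true → S z ≡ true) × (W x ≡ true → z ≡ x) × (S' x ≡ true → Good x z ⊎ (z ≡ x × Bad x))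
      gΣ x = go (S' x ∧ atLast x) refl (found x) refl
        where
        go : ∀ c → (S' x ∧ atLast x) ≡ c → ∀ f → found x ≡ f →
             Σ (Fin N) λ z → (S x ≡ true → S z ≡ true) × (W x ≡ true → z ≡ x) × (S' x ≡ true → Good x z ⊎ (z ≡ x × Bad x))
        go true c true f with anyB-sound N _ f
        ... | a , ha with ∧-split {S a} ha
        ...   | sa , oa = a , (λ _ → sa) , (λ wx → ⊥-elim (t≢f (trans (sym wx) (S'-W x (proj₁ (∧-split {S' x} c))))))
                           , λ _ → inj₁ (sa , offB-sound j (ψ a) (ψ' x) oa)
        go true c false f = x , (λ s → s) , (λ _ → refl) , λ _ → inj₂ (refl , proj₂ (∧-split {S' x} c) , λ a sa → nf a sa)
          where nf : ∀ a → S a ≡ true → offB j (ψ a) (ψ' x) ≡ false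
                nf a sa with offB j (ψ a) (ψ' x) in e
                ... | false = refl
                ... | true = ⊥-elim (t≢f (trans (sym (∧-intro sa e)) (anyB-false N _ f a)))
        go false c f _ = x , (λ s → s) , (λ _ → refl) , λ s'x → inj₁ (S'-S x s'x , λ i _ → sym (ψ'-notLast x (nN s'x) i))
          where andF : ∀ {a b} → (a ∧ b) ≡ false → a ≡ true → b ≡ false
                andF {true} e refl = e
                nN : S' x ≡ true → atLast x ≡ false
                nN s'x = andF c s'x

      g : Fin N → Fin N
      g x = proj₁ (gΣ x)

      CW CG CB : Fin N → Set
      CW x = W x ≡ true × g x ≡ x
      CG x = S' x ≡ true × Good x (g x)
      CB x = S' x ≡ true × g x ≡ x × Bad x

      cls : ∀ x → S x ≡ true → CW x ⊎ (CG x ⊎ CB x)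
      cls x sx with S-cases x sx
      ... | inj₁ wx = inj₁ (wx , proj₁ (proj₂ (proj₂ (gΣ x))) wx)
      ... | inj₂ s'x with proj₂ (proj₂ (proj₂ (gΣ x))) s'x
      ...   | inj₁ gd = inj₂ (inj₁ (s'x , gd))
      ...   | inj₂ (e , bd) = inj₂ (inj₂ (s'x , e , bd))

      gS : ∀ x → S x ≡ true → S (g x) ≡ true
      gS x sx = proj₁ (proj₂ (gΣ x)) sx

      -- the image of a good point is never at the last rank (j ≠ j0 keeps coordinate j0)
      G3 : ∀ x → CG x → ¬ ψ (g x) j0 ≡ last
      G3 x (s'x , sz , off) e = go (atLast x) refl
        where
        go : ∀ b → atLast x ≡ b → ⊥
        go true nx = lastPar≢last (trans (sym (upd-at (ψ x) j0 lastPar)) (trans (sym (ψ'-atLast x nx j0)) (trans (sym (off j0 (λ q → j≢j0 (sym q)))) e)))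
        go false nx = eqN-false nx (trans (sym (ψ'-notLast x nx j0)) (trans (sym (off j0 (λ q → j≢j0 (sym q)))) e))

      offT : ∀ u w → offB j u w ≡ true → Off j u w
      offT = offB-sound j
      offI : ∀ u w → Off j u w → offB j u w ≡ true
      offI = offB-complete j

      both-false : ∀ {a b} → (a ≡ true → ⊥) → (b ≡ true → ⊥) → a ≡ b
      both-false {a} {b} f1 f2 = bool-ext (λ t → ⊥-elim (f1 t)) (λ t → ⊥-elim (f2 t))

      GB : ∀ x y → CG x → CB y → offB j (ψ' x) (ψ' y) ≡ offB j (ψ (g x)) (ψ (g y))
      GB x y (sx , sgx , offx) (sy , gy , ny , bad) = both-false l r
        where
        l : offB j (ψ' x) (ψ' y) ≡ true → ⊥
        l e = t≢f (trans (sym (offI (ψ (g x)) (ψ' y) (λ i ne → trans (offx i ne) (offT (ψ' x) (ψ' y) e i ne)))) (bad (g x) sgx))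
        r : offB j (ψ (g x)) (ψ (g y)) ≡ true → ⊥
        r e = G3 x (sx , sgx , offx) (trans (offT (ψ (g x)) (ψ (g y)) e j0 (λ q → j≢j0 (sym q))) (trans (cong (λ z → ψ z j0) gy) (atLast-≡ y ny)))

      BB : ∀ x y → CB x → CB y → offB j (ψ' x) (ψ' y) ≡ offB j (ψ (g x)) (ψ (g y))
      BB x y (sx , gx , nx , _) (sy , gy , ny , _) rewrite gx | gy = bool-ext
          (λ e → offI (ψ x) (ψ y) (λ i ne → k1 i ne (offT (ψ' x) (ψ' y) e i ne)))
          (λ e → offI (ψ' x) (ψ' y) (λ i ne → k2 i ne (offT (ψ x) (ψ y) e i ne)))
        where
        k1 : ∀ i → ¬ i ≡ j → ψ' x i ≡ ψ' y i → ψ x i ≡ ψ y i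
        k1 i ne h with i Data.Fin.≟ j0
        ... | yes refl = trans (atLast-≡ x nx) (sym (atLast-≡ y ny))
        ... | no ne0 = trans (sym (ψ'-other x i ne0)) (trans h (ψ'-other y i ne0))
        k2 : ∀ i → ¬ i ≡ j → ψ x i ≡ ψ y i → ψ' x i ≡ ψ' y i
        k2 i ne h with i Data.Fin.≟ j0
        ... | yes refl = trans (ψ'-atLast x nx i) (trans (upd-at (ψ x) i lastPar) (sym (trans (ψ'-atLast y ny i) (upd-at (ψ y) i lastPar))))
        ... | no ne0 = trans (ψ'-other x i ne0) (trans h (sym (ψ'-other y i ne0)))

      GW : ∀ x y → CG x → CW y → offB j (ψ (g x)) (ψ (g y)) ≡ false
      GW x y cg (wy , gy) with offB j (ψ (g x)) (ψ (g y)) in e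
      ... | false = refl
      ... | true = ⊥-elim (G3 x cg (trans (offT (ψ (g x)) (ψ (g y)) e j0 (λ q → j≢j0 (sym q))) (trans (cong (λ z → ψ z j0) gy) (atLast-≡ y (W-N y wy)))))

      BW : ∀ x y → CB x → CW y → offB j (ψ (g x)) (ψ (g y)) ≡ false
      BW x y (sx , gx , nx , bad) (wy , gy) with offB j (ψ (g x)) (ψ (g y)) in e
      ... | false = refl
      ... | true with W-part y wy
      ...   | z , sz , pz = ⊥-elim (t≢f (trans (sym (offI (ψ z) (ψ' x) k)) (bad z sz)))
        where
        e' : Off j (ψ x) (ψ y)
        e' i ne = trans (cong (λ u → ψ u i) (sym gx)) (trans (offT (ψ (g x)) (ψ (g y)) e i ne) (cong (λ u → ψ u i) gy))
        k : Off j (ψ z) (ψ' x)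
        k i ne with i Data.Fin.≟ j0
        ... | yes refl = trans (pz i) (trans (upd-at (ψ y) i lastPar) (sym (trans (ψ'-atLast x nx i) (upd-at (ψ x) i lastPar))))
        ... | no ne0 = trans (pz i) (trans (upd-other (ψ y) j0 lastPar i ne0) (trans (sym (e' i ne)) (sym (ψ'-other x i ne0))))

      offsym : ∀ u w → offB j u w ≡ offB j w u
      offsym u w = bool-ext (offB-sym j u w) (offB-sym j w u)

      gE : ∀ x y → S x ≡ true → S y ≡ true → Est x y ≡ offB j (ψ (g x)) (ψ (g y))
      gE x y sx sy with cls x sx | cls y sy
      ... | inj₁ (wx , gx) | inj₁ (wy , gy) rewrite gx | gy = Est-WW x y wx wy
      ... | inj₁ cw | inj₂ (inj₁ cg) = trans (Est-WS' x y (proj₁ cw) (proj₁ cg)) (sym (trans (offsym (ψ (g x)) (ψ (g y))) (GW y x cg cw)))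
      ... | inj₁ cw | inj₂ (inj₂ cb) = trans (Est-WS' x y (proj₁ cw) (proj₁ cb)) (sym (trans (offsym (ψ (g x)) (ψ (g y))) (BW y x cb cw)))
      ... | inj₂ (inj₁ cg) | inj₁ cw = trans (Est-S'W x y (proj₁ cg) (proj₁ cw)) (sym (GW x y cg cw))
      ... | inj₂ (inj₂ cb) | inj₁ cw = trans (Est-S'W x y (proj₁ cb) (proj₁ cw)) (sym (BW x y cb cw))
      ... | inj₂ (inj₁ cg) | inj₂ (inj₁ cg') = trans (Est-S'S' x y (proj₁ cg) (proj₁ cg'))
              (offB-cong j (ψ' x) (ψ (g x)) (ψ' y) (ψ (g y)) (λ i ne → sym (proj₂ (proj₂ cg) i ne)) (λ i ne → sym (proj₂ (proj₂ cg') i ne)))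
      ... | inj₂ (inj₁ cg) | inj₂ (inj₂ cb) = trans (Est-S'S' x y (proj₁ cg) (proj₁ cb)) (GB x y cg cb)
      ... | inj₂ (inj₂ cb) | inj₂ (inj₁ cg) = trans (Est-S'S' x y (proj₁ cb) (proj₁ cg))
              (trans (offsym (ψ' x) (ψ' y)) (trans (GB y x cg cb) (offsym (ψ (g y)) (ψ (g x)))))
      ... | inj₂ (inj₂ cb) | inj₂ (inj₂ cb') = trans (Est-S'S' x y (proj₁ cb) (proj₁ cb')) (BB x y cb cb')

      Est-sym : ∀ x y → Est x y ≡ true → Est y x ≡ true
      Est-sym x y e with ∨-elim {S' x ∧ (S' y ∧ offB j (ψ' x) (ψ' y))} e
      ... | inj₁ h with ∧-split {S' x} h
      ...   | sx , h2 with ∧-split {S' y} h2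
      ...     | sy , o = trans (Est-S'S' y x sy sx) (offB-sym j (ψ' x) (ψ' y) o)
      Est-sym x y e | inj₂ h with ∧-split {W x} h
      ...   | wx , h2 with ∧-split {W y} h2
      ...     | wy , o = trans (Est-WW y x wy wx) (offB-sym j (ψ x) (ψ y) o)

      Est-refl : ∀ x → S x ≡ true → Est x x ≡ true
      Est-refl x sx with S-cases x sx
      ... | inj₁ wx = trans (Est-WW x x wx wx) (offB-refl j (ψ x))
      ... | inj₂ s'x = trans (Est-S'S' x x s'x s'x) (offB-refl j (ψ' x))

      Est-classes≤lines : cl S Est ≤ lines j S ψ
      Est-classes≤lines = classMap S S Est (sameLine j ψ) g Est-refl Est-sym (λ x y → offB-sym j (ψ x) (ψ y))
                (λ x y z → offB-trans j (ψ x) (ψ y) (ψ z)) gS gE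

      S'false : ∀ x → S x ≡ false → S' x ≡ false
      S'false x e rewrite e = refl
      Wfalse : ∀ x → S x ≡ false → W x ≡ false
      Wfalse x e rewrite e = refl

      rep-stuck : ∀ x → W x ≡ true → isRep S Est x ≡ isRep W (sameLine j ψ) x
      rep-stuck x wx = bool-ext
        (λ r → rep-intro W (sameLine j ψ) x wx (λ y wy lt → k1 r y wy lt))
        (λ r → rep-intro S Est x (W-S x wx) (λ y sy lt → k2 r y sy lt))
        where
        k1 : isRep S Est x ≡ true → ∀ y → W y ≡ true → toℕ y < toℕ x → sameLine j ψ y x ≡ false
        k1 r y wy lt = trans (sym (Est-WW y x wy wx)) (rep-no S Est x r y (W-S y wy) lt)
        k2 : isRep W (sameLine j ψ) x ≡ true → ∀ y → S y ≡ true → toℕ y < toℕ x → Est y x ≡ false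
        k2 r y sy lt with S-cases y sy
        ... | inj₁ wy = trans (Est-WW y x wy wx) (rep-no W (sameLine j ψ) x r y wy lt)
        ... | inj₂ s'y = Est-S'W y x s'y wx

      rep-compressed : ∀ x → S' x ≡ true → isRep S Est x ≡ isRep S' (sameLine j ψ') x
      rep-compressed x s'x = bool-ext
        (λ r → rep-intro S' (sameLine j ψ') x s'x (λ y s'y lt → k1 r y s'y lt))
        (λ r → rep-intro S Est x (S'-S x s'x) (λ y sy lt → k2 r y sy lt))
        where
        k1 : isRep S Est x ≡ true → ∀ y → S' y ≡ true → toℕ y < toℕ x → sameLine j ψ' y x ≡ false
        k1 r y s'y lt = trans (sym (Est-S'S' y x s'y s'x)) (rep-no S Est x r y (S'-S y s'y) lt)
        k2 : isRep S' (sameLine j ψ') x ≡ true → ∀ y → S y ≡ true → toℕ y < toℕ x → Est y x ≡ false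
        k2 r y sy lt with S-cases y sy
        ... | inj₁ wy = Est-WS' y x wy s'x
        ... | inj₂ s'y = trans (Est-S'S' y x s'y s'x) (rep-no S' (sameLine j ψ') x r y s'y lt)

      rep-split : ∀ x → ind (isRep S Est x) ≡ ind (isRep S' (sameLine j ψ') x) + ind (isRep W (sameLine j ψ) x)
      rep-split x = go (S x) refl
        where
        go : ∀ b → S x ≡ b → ind (isRep S Est x) ≡ ind (isRep S' (sameLine j ψ') x) + ind (isRep W (sameLine j ψ) x)
        go false sx rewrite rep-false S Est x sx | rep-false S' (sameLine j ψ') x (S'false x sx) | rep-false W (sameLine j ψ) x (Wfalse x sx) = refl
        go true sx with S-cases x sx
        ... | inj₁ wx rewrite rep-stuck x wx | rep-false S' (sameLine j ψ') x (WS' x wx) = refl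
        ... | inj₂ s'x rewrite rep-compressed x s'x | rep-false W (sameLine j ψ) x (S'-W x s'x) = +-comm 0 _

      Est-classes : cl S Est ≡ lines j S' ψ' + lines j W ψ
      Est-classes = trans (countB-sum N _) (trans (sumF-cong N rep-split) (trans (sumF-+ N _ _)
                (cong₂ _+_ (sym (countB-sum N _)) (sym (countB-sum N _)))))

      lines-split : lines j S' ψ' + lines j W ψ ≤ lines j S ψ
      lines-split = subst (_≤ lines j S ψ) Est-classes Est-classes≤lines

    -- summed over all directions: the lines of S' and of W together exceed those of S by
    -- at most |W|, the excess coming from direction j0 only
    lines-total : sumF m (λ j → lines j S' ψ') + sumF m (λ j → lines j W ψ) ≤ sumF m (λ j → lines j S ψ) + countB N W
    lines-total = subst₂ _≤_ (sumF-+ m _ _) (trans (sumF-+ m _ _) (cong (sumF m (λ j → lines j S ψ) +_) (sum-single m j0 (countB N W))))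
                    (sumF-mono m lines-per-direction)
      where
      lines-per-direction : ∀ j → lines j S' ψ' + lines j W ψ ≤ lines j S ψ + ind (eqF j j0) * countB N W
      lines-per-direction j with j Data.Fin.≟ j0
      ... | yes refl rewrite eqF-refl j | +-identityʳ (countB N W) = ≤-reflexive (cong₂ _+_ compressed-lines-j0 stuck-lines-j0)
      ... | no ne rewrite eqF-≢ ne | +-identityʳ (lines j S ψ) = OtherDirection.lines-split j ne
combine-bounds : ∀ m d e s' w A B C → m * s' ≤ d * s' + A → m * w ≤ e * w + B → A + B ≤ C + w → e * w + w ≡ d * w →
        m * (s' + w) ≤ d * (s' + w) + C
combine-bounds m d e s' w A B C h1 h2 h3 h4 = begin
  m * (s' + w) ≡⟨ *-distribˡ-+ m s' w ⟩
  m * s' + m * w ≤⟨ +-mono-≤ h1 h2 ⟩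
  (d * s' + A) + (e * w + B) ≡⟨ solve (d ∷ s' ∷ A ∷ e ∷ w ∷ B ∷ []) ⟩
  (d * s' + e * w) + (A + B) ≤⟨ +-monoʳ-≤ (d * s' + e * w) h3 ⟩
  (d * s' + e * w) + (C + w) ≡⟨ solve (d ∷ s' ∷ e ∷ w ∷ C ∷ []) ⟩
  d * s' + (e * w + w) + C ≡⟨ cong (λ z → d * s' + z + C) h4 ⟩
  d * s' + d * w + C ≡⟨ cong (_+ C) (sym (*-distribˡ-+ d s' w)) ⟩
  d * (s' + w) + C ∎
  where open ≤-Reasoning

module ShiftingBound (m N : ℕ) (par : Fin m → ℕ → ℕ) (par< : ∀ j i → 1 ≤ i → par j i < i) where
  open Pts m
  open Shifting m N par par<
  open Cls N using (isRep; rep-intro; rep-S)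

  -- if every direction has a single rank, every point is its own j-line for all j
  flat-bound : ∀ S ψ nb d → (∀ j → nb j ≤ 1) → RanksBelow S ψ nb → InjectiveOn S ψ →
         m * countB N S ≤ d * countB N S + sumF m (λ j → lines j S ψ)
  flat-bound S ψ nb d h bnd inj = subst (λ z → m * countB N S ≤ d * countB N S + z) (sym eq) (m≤n+m _ _)
    where
    zero-c : ∀ x → S x ≡ true → ∀ j → ψ x j ≡ 0
    zero-c x sx j = n<1⇒n≡0 (≤-trans (bnd x sx j) (h j))
    every-point-represents : ∀ j x → isRep S (sameLine j ψ) x ≡ S x
    every-point-represents j x = bool-ext (rep-S S (sameLine j ψ) x) λ sx → rep-intro S (sameLine j ψ) x sx λ y sy lt →
      ⊥-elim (<-irrefl (cong toℕ (inj y x sy sx (λ i → trans (zero-c y sy i) (sym (zero-c x sx i))))) lt)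
    eq : sumF m (λ j → lines j S ψ) ≡ m * countB N S
    eq = trans (sumF-cong m (λ j → countB-cong N (every-point-represents j))) (sumF-const m _)

  -- otherwise compress in some direction j0 with nb j0 ≥ 2 and apply induction to S'
  -- (dimension d) and to W (dimension d − 1)
  shifting-bound : ∀ k S ψ nb d → countB N S + sumF m nb < k → RanksBelow S ψ nb → InjectiveOn S ψ → DimAtMost S ψ nb d →
         m * countB N S ≤ d * countB N S + sumF m (λ j → lines j S ψ)
  shifting-bound (suc k) S ψ nb d lt bnd inj dim with search m (λ j → 1 <ᵇ nb j)
  ... | inj₂ h = flat-bound S ψ nb d (λ j → ltb-false 1 (nb j) (h j)) bnd inj
  ... | inj₁ (j0 , h0) = subst (λ z → m * z ≤ d * z + sumF m (λ j → lines j S ψ)) (sym size-split)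
      (combine-bounds m d (d ∸ 1) (countB N S') (countB N W) _ _ _ compressed-bound (proj₁ stuck-bound) lines-total (proj₂ stuck-bound))
    where
    open Shifting.Compress m N par par< S ψ nb j0 (ltb-true 1 (nb j0) h0) bnd inj
    nb-drops : sumF m nb' < sumF m nb
    nb-drops = sumF-strict m nb' nb j0 nb'≤nb (subst (_< nb j0) (sym (upd-at nb j0 last)) (subst (last <_) suc-last ≤-refl))
    compressed-bound : m * countB N S' ≤ d * countB N S' + sumF m (λ j → lines j S' ψ')
    compressed-bound = shifting-bound k S' ψ' nb' d (≤-trans (+-mono-≤-< (subst (countB N S' ≤_) (sym size-split) (m≤m+n _ _)) nb-drops) (≤-pred lt))
            compressed-ranks compressed-injective (compressed-dim d dim)

    stuck-bound : m * countB N W ≤ (d ∸ 1) * countB N W + sumF m (λ j → lines j W ψ)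
                  × (d ∸ 1) * countB N W + countB N W ≡ d * countB N W
    stuck-bound with countB N W in cw
    ... | zero = subst (_≤ (d ∸ 1) * 0 + sumF m (λ j → lines j W ψ)) (sym (*-zeroʳ m)) z≤n , trans (+-identityʳ _) (trans (*-zeroʳ (d ∸ 1)) (sym (*-zeroʳ d)))
    ... | suc w with countB-wit N W w cw
    ...   | x , wx = subst (λ z → m * z ≤ (d ∸ 1) * z + sumF m (λ j → lines j W ψ)) cw induction
                   , trans (+-comm _ (suc w)) (cong (_* suc w) (m+[n∸m]≡n (stuck⇒dim≥1 d dim x wx)))
      where
      stuck<S : countB N W < countB N S
      stuck<S with W-part x wx
      ... | y , py = subst (countB N W <_) (sym size-split)
                       (+-monoˡ-≤ (countB N W) (countB-pos N S' y (partner-S' x y py)))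
      induction : m * countB N W ≤ (d ∸ 1) * countB N W + sumF m (λ j → lines j W ψ)
      induction = shifting-bound k W ψ nb (d ∸ 1) (≤-trans (+-monoˡ-< (sumF m nb) stuck<S) (≤-pred lt))
                    (λ y wy → bnd y (W-S y wy)) (λ a b wa wb → inj a b (W-S a wa) (W-S b wb)) (stuck-dim d dim)
-- Arithmetic behind the bound  |E| ≤ c(k − 1)  for H-minor-free graphs on k ≥ 1 vertices.
-- The identity below is  (c+1)k + 2c = 2ck + 1 + (slack)  for c = u + 2 and k = 2u + 5 + t.
poly-identity : ∀ u t → (3 + u) * (5 + 2 * u + t) + 2 * (2 + u) + (2 + 5 * u + 2 * u * u + (1 + u) * t) ≡ 2 * (2 + u) * (5 + 2 * u + t) + 1
poly-identity u t = solve (u ∷ t ∷ [])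

half-< : ∀ t k → t + t < k + k → t < k
half-< t k h with <-cmp t k
... | tri< a _ _ = a
... | tri≈ _ refl _ = ⊥-elim (<-irrefl refl h)
... | tri> _ _ c = ⊥-elim (<-asym h (+-mono-< c c))

density< : ∀ p q c s k → p < suc c * q → s * q ≤ p * suc k → s < suc c * suc k
density< p q c s k pq sq = *-cancelʳ-< q s (suc c * suc k)
  (≤-trans (s≤s sq) (subst (suc (p * suc k) ≤_) e (*-monoˡ-< (suc k) pq)))
  where e : suc c * q * suc k ≡ suc c * suc k * q
        e = solve (c ∷ k ∷ q ∷ [])

-- with μ = p/q < c + 1, a graph on k ≥ 1 vertices with degree sum s = 2|E| ≤ μk and
-- s ≤ k(k − 1) has s + 2c ≤ 2ck: for c = 1 since s < 2k and s is even; for c ≥ 2 either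
-- k ≤ 2c and k(k − 1) ≤ 2c(k − 1), or k > 2c and (c + 1)k ≤ 2c(k − 1) + 1
minor-free-edges : ∀ p q c s k → 1 ≤ c → p < suc c * q → s * q ≤ p * k → s ≤ k * (k ∸ 1) → (Σ ℕ λ t → s ≡ t + t) → 1 ≤ k →
  s + 2 * c ≤ 2 * c * k
minor-free-edges p q (suc zero) s (suc k') c1 pq sq sk (t , refl) k1 =
  subst₂ _≤_ e1 e2 (+-mono-≤ tk tk)
  where
  e1 : suc t + suc t ≡ t + t + 2 * 1
  e1 = solve (t ∷ [])
  e2 : suc k' + suc k' ≡ 2 * 1 * suc k'
  e2 = solve (k' ∷ [])
  e3 : 2 * suc k' ≡ suc k' + suc k'
  e3 = solve (k' ∷ [])
  st : t + t < 2 * suc k'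
  st = density< p q 1 (t + t) k' pq sq
  tk : suc t ≤ suc k'
  tk = half-< t (suc k') (subst (t + t <_) e3 st)
minor-free-edges p q (suc (suc u)) s (suc k') c1 pq sq sk ev k1 with suc k' ≤? 2 * suc (suc u)
... | yes le = ≤-trans (+-monoˡ-≤ (2 * suc (suc u)) (≤-trans sk (*-monoˡ-≤ k' le))) (≤-reflexive e)
  where e : 2 * suc (suc u) * k' + 2 * suc (suc u) ≡ 2 * suc (suc u) * suc k'
        e = solve (u ∷ k' ∷ [])
... | no gt = ≤-pred (≤-trans (+-monoˡ-≤ (2 * c) lt) (subst (suc c * suc k' + 2 * c ≤_) (+-comm (2 * c * suc k') 1) fin))
  where
  c = suc (suc u)
  lt : suc s ≤ suc c * suc k'
  lt = density< p q c s k' pq sq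
  kge : 5 + 2 * u ≤ suc k'
  kge = subst (_≤ suc k') e (≰⇒> gt)
    where e : suc (2 * suc (suc u)) ≡ 5 + 2 * u
          e = solve (u ∷ [])
  tu = suc k' ∸ (5 + 2 * u)
  kk : suc k' ≡ 5 + 2 * u + tu
  kk = sym (m+[n∸m]≡n kge)
  fin : suc c * suc k' + 2 * c ≤ 2 * c * suc k' + 1
  fin = subst₂ (λ a b → a + 2 * c ≤ b + 1) (cong (suc c *_) (sym kk)) (cong (2 * c *_) (sym kk))
          (subst ((3 + u) * (5 + 2 * u + tu) + 2 * (2 + u) ≤_) (poly-identity u tu) (m≤m+n _ (2 + 5 * u + 2 * u * u + (1 + u) * tu)))

-- Edges along lines.  For a subgraph G of the product (embedded by φ, ranks ψ) and a
-- direction j, degAlong j S counts the degree sum of the edges of G[S] in direction j.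
-- Each j-line L meets G in a graph embedding in G_j, hence H-minor-free, so
-- degIn G L + 2c ≤ 2c|L|; summing over the j-lines met by S gives degAlong-bound.
module LineBound (H G : Graph) (m : ℕ) (Gs : Fin m → Graph) (φ : Fin (size G) → ProdV Gs) (sub : IsSubgraphVia Gs G φ)
  (ψ : Fin (size G) → Fin m → ℕ) (ψφ : ∀ x y i → ψ x i ≡ ψ y i → φ x i ≡ φ y i)
  (free : ∀ i → ¬ Minor H (Gs i))
  (p q c : ℕ) (hF : ∀ F → ¬ Minor H F → degSum F * q ≤ p * size F) (c1 : 1 ≤ c) (pq : p < suc c * q) where

  open Pts m
  open Cls (size G) using (isRep; cl; rep-no; rep-intro; rep-false)
  n = size G

  degAlong : Fin m → (Fin n → Bool) → ℕ
  degAlong j S = sumF n (λ x → ind (S x) * countB n (λ y → S y ∧ (adj G x y ∧ offB j (ψ x) (ψ y))))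

  lines : Fin m → (Fin n → Bool) → ℕ
  lines j S = cl S (λ y x → offB j (ψ y) (ψ x))

  line-edges : ∀ j (L : Fin n → Bool) x0 → L x0 ≡ true → (∀ x y → L x ≡ true → L y ≡ true → Off j (ψ x) (ψ y)) →
    degIn G L + 2 * c ≤ 2 * c * countB n L
  line-edges j L x0 cx0 same = subst (λ z → z + 2 * c ≤ 2 * c * countB n L) (degSum-induced G L)
      (minor-free-edges p q c (degSum F) (size F) c1 pq (hF F no-H-minor) (degSum≤ F)
        (handshake (size F) (adj F) (Graph.sym F) (irrefl F)) (countB-pos n L x0 cx0))
    where
    -- the points of L, mapped to their j-th coordinate, embed G[L] into G_j
    F = induced G L
    e = enum n L
    ι : Fin (size F) → Fin (size (Gs j))
    ι i = φ (e i) j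
    same-off-j : ∀ i i' → ∀ k → ¬ k ≡ j → φ (e i) k ≡ φ (e i') k
    same-off-j i i' k ne = ψφ (e i) (e i') k (same (e i) (e i') (enum-C n L i) (enum-C n L i') k ne)
    ι-inj : ∀ i i' → ι i ≡ ι i' → i ≡ i'
    ι-inj i i' h = enum-inj n L i i' (proj₁ sub (e i) (e i') λ k → go k)
      where go : ∀ k → φ (e i) k ≡ φ (e i') k
            go k with k Data.Fin.≟ j
            ... | yes refl = h
            ... | no ne = same-off-j i i' k ne
    ι-hom : ∀ i i' → adj F i i' ≡ true → adj (Gs j) (ι i) (ι i') ≡ true
    ι-hom i i' a with proj₂ sub (e i) (e i') a
    ... | j' , eqs , a' with j' Data.Fin.≟ j
    ...   | yes refl = a'
    ...   | no ne = ⊥-elim (t≢f (trans (sym a') (subst (λ z → adj (Gs j') (φ (e i) j') z ≡ false) (same-off-j i i' j' ne) (irrefl (Gs j') _))))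
    no-H-minor : ¬ Minor H F
    no-H-minor mn = free j (minor-transfer H F (Gs j) ι ι-inj ι-hom mn)

  module PeelLine (j : Fin m) (S : Fin n → Bool) (x0 : Fin n) (s0 : S x0 ≡ true) (mn : ∀ y → toℕ y < toℕ x0 → S y ≡ false) where
    onL : Fin n → Bool
    onL y = offB j (ψ x0) (ψ y)
    sameLineB : Fin n → Fin n → Bool
    sameLineB x y = offB j (ψ x) (ψ y)
    L Rest : Fin n → Bool
    L y = S y ∧ onL y
    Rest y = S y ∧ not (onL y)

    sameLineB-trans : ∀ x y z → sameLineB x y ≡ true → sameLineB y z ≡ true → sameLineB x z ≡ true
    sameLineB-trans x y z = offB-trans j (ψ x) (ψ y) (ψ z)
    sameLineB-sym : ∀ x y → sameLineB x y ≡ true → sameLineB y x ≡ true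
    sameLineB-sym x y = offB-sym j (ψ x) (ψ y)

    x0-min : ∀ x → S x ≡ true → ¬ x ≡ x0 → toℕ x0 < toℕ x
    x0-min x sx ne with <-cmp (toℕ x) (toℕ x0)
    ... | tri< a _ _ = ⊥-elim (t≢f (trans (sym sx) (mn x a)))
    ... | tri≈ _ b _ = ⊥-elim (ne (toℕ-injective b))
    ... | tri> _ _ c = c

    size-split : countB n S ≡ countB n L + countB n Rest
    size-split = trans (countB-sum n S) (trans (sumF-cong n pw) (trans (sumF-+ n _ _) (cong₂ _+_ (sym (countB-sum n L)) (sym (countB-sum n Rest)))))
      where
      sp : ∀ a b → ind a ≡ ind (a ∧ b) + ind (a ∧ not b)
      sp true true = refl
      sp true false = refl
      sp false b = refl
      pw : ∀ x → ind (S x) ≡ ind (L x) + ind (Rest x)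
      pw x = sp (S x) (onL x)

    E : Fin n → Fin n → Bool
    E y x = offB j (ψ y) (ψ x)

    Rest-S : ∀ x → Rest x ≡ true → S x ≡ true
    Rest-S x e = proj₁ (∧-split {S x} e)

    notrep : ∀ x → S x ≡ true → onL x ≡ true → ¬ x ≡ x0 → isRep S E x ≡ false
    notrep x sx ox ne with isRep S E x in r
    ... | false = refl
    ... | true = ⊥-elim (t≢f (trans (sym ox) (rep-no S E x r x0 s0 (x0-min x sx ne))))

    rep-split : ∀ x → ind (isRep S E x) ≡ ind (eqF x x0) + ind (isRep Rest E x)
    rep-split x = go (S x) refl (onL x) refl
      where
      go : ∀ b → S x ≡ b → ∀ b' → onL x ≡ b' → ind (isRep S E x) ≡ ind (eqF x x0) + ind (isRep Rest E x)
      go false sx _ _ rewrite rep-false S E x sx | rep-false Rest E x (subst (λ z → (z ∧ not (onL x)) ≡ false) (sym sx) refl)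
                            | eqF-≢ {a = x} {b = x0} (λ e → t≢f (trans (sym s0) (trans (cong S (sym e)) sx))) = refl
      go true sx true ox with x Data.Fin.≟ x0
      ... | yes refl rewrite eqF-refl x | rep-false Rest E x (subst₂ (λ a b → (a ∧ not b) ≡ false) (sym sx) (sym ox) refl)
                     | rep-intro S E x sx (λ y sy lt → ⊥-elim (t≢f (trans (sym sy) (mn y lt)))) = refl
      ... | no ne rewrite eqF-≢ ne | rep-false Rest E x (subst₂ (λ a b → (a ∧ not b) ≡ false) (sym sx) (sym ox) refl)
                     | notrep x sx ox ne = refl
      go true sx false ox rewrite eqF-≢ {a = x} {b = x0} (λ e → t≢f (trans (sym (subst (λ z → onL z ≡ true) (sym e) (offB-refl j (ψ x0)))) ox))
        = cong ind (bool-ext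
            (λ r → rep-intro Rest E x restx (λ y resty lt → rep-no S E x r y (Rest-S y resty) lt))
            (λ r → rep-intro S E x sx (λ y sy lt → k r y sy lt)))
        where
        restx : Rest x ≡ true
        restx = ∧-intro sx (not-f ox)
        k : isRep Rest E x ≡ true → ∀ y → S y ≡ true → toℕ y < toℕ x → E y x ≡ false
        k r y sy lt with onL y in oy
        ... | false = rep-no Rest E x r y (∧-intro sy (not-f oy)) lt
        ... | true with E y x in eyx
        ...   | false = refl
        ...   | true = ⊥-elim (t≢f (trans (sym (sameLineB-trans x0 y x oy eyx)) ox))

    imf : ∀ {b} → b ≡ false → ∀ k → ind b * k ≡ 0
    imf refl k = refl
    imt : ∀ {b} → b ≡ true → ∀ k → ind b * k ≡ k
    imt refl k = +-identityʳ k

    deg-split : ∀ x → ind (S x) * countB n (λ y → S y ∧ (adj G x y ∧ sameLineB x y)) ≡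
               ind (L x) * countB n (λ y → L y ∧ adj G x y) + ind (Rest x) * countB n (λ y → Rest y ∧ (adj G x y ∧ sameLineB x y))
    deg-split x = go (S x) refl (onL x) refl
      where
      Sc = countB n (λ y → S y ∧ (adj G x y ∧ sameLineB x y))
      Lc = countB n (λ y → L y ∧ adj G x y)
      Rc = countB n (λ y → Rest y ∧ (adj G x y ∧ sameLineB x y))
      go : ∀ b → S x ≡ b → ∀ b' → onL x ≡ b' → ind (S x) * Sc ≡ ind (L x) * Lc + ind (Rest x) * Rc
      go false sx _ _ = trans (imf sx Sc) (sym (cong₂ _+_ (imf (cong (_∧ onL x) sx) Lc) (imf (cong (λ z → z ∧ not (onL x)) sx) Rc)))
      go true sx true ox = trans (imt sx Sc) (sym (trans (cong₂ _+_ (imt (∧-intro sx ox) Lc)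
                               (imf (subst₂ (λ a b → (a ∧ not b) ≡ false) (sym sx) (sym ox) refl) Rc)) (trans (+-identityʳ Lc) (countB-cong n k))))
        where
        k : ∀ y → (L y ∧ adj G x y) ≡ (S y ∧ (adj G x y ∧ sameLineB x y))
        k y = bool-ext
          (λ h → let a = ∧-split {L y} h ; b = ∧-split {S y} (proj₁ a) in
             ∧-intro (proj₁ b) (∧-intro (proj₂ a) (sameLineB-trans x x0 y (sameLineB-sym x0 x ox) (proj₂ b))))
          (λ h → let a = ∧-split {S y} h ; b = ∧-split {adj G x y} (proj₂ a) in
             ∧-intro (∧-intro (proj₁ a) (sameLineB-trans x0 x y ox (proj₂ b))) (proj₁ b))
      go true sx false ox = trans (imt sx Sc) (sym (trans (cong₂ _+_ (imf (trans (cong (_∧ onL x) sx) ox') Lc)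
                               (imt (∧-intro sx (not-f ox)) Rc)) (countB-cong n k)))
        where
        ox' : (true ∧ onL x) ≡ false
        ox' = ox
        k : ∀ y → (Rest y ∧ (adj G x y ∧ sameLineB x y)) ≡ (S y ∧ (adj G x y ∧ sameLineB x y))
        k y = bool-ext
          (λ h → let a = ∧-split {Rest y} h in ∧-intro (Rest-S y (proj₁ a)) (proj₂ a))
          (λ h → let a = ∧-split {S y} h ; b = ∧-split {adj G x y} (proj₂ a) in
             ∧-intro (∧-intro (proj₁ a) (not-f (noty (proj₂ b)))) (proj₂ a))
          where noty : sameLineB x y ≡ true → onL y ≡ false
                noty e with onL y in oy
                ... | false = refl
                ... | true = ⊥-elim (t≢f (trans (sym (sameLineB-trans x0 y x oy (sameLineB-sym x y e))) ox))

    degAlong-split : degAlong j S ≡ degIn G L + degAlong j Rest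
    degAlong-split = trans (sumF-cong n deg-split) (sumF-+ n _ _)

    lines-split : lines j S ≡ suc (lines j Rest)
    lines-split = trans (countB-sum n _) (trans (sumF-cong n rep-split) (trans (sumF-+ n _ _)
                (cong₂ _+_ (trans (sym (countB-sum n (λ x → eqF x x0))) (countB-single n x0)) (sym (countB-sum n _)))))

    L-on-line : ∀ x y → L x ≡ true → L y ≡ true → Off j (ψ x) (ψ y)
    L-on-line x y cx cy = offB-sound j (ψ x) (ψ y) (sameLineB-trans x x0 y (sameLineB-sym x0 x (proj₂ (∧-split {S x} cx))) (proj₂ (∧-split {S y} cy)))

    x0∈L : L x0 ≡ true
    x0∈L = ∧-intro s0 (offB-refl j (ψ x0))

  degAlong-bound : ∀ k j S → countB n S < k → degAlong j S + 2 * c * lines j S ≤ 2 * c * countB n S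
  degAlong-bound (suc k) j S lt with searchMin n S
  ... | inj₂ h = ≤-reflexive (trans (cong₂ _+_ d0 (cong (2 * c *_) c0)) (cong (2 * c *_) (sym s0)))
    where
    d0 : degAlong j S ≡ 0
    d0 = trans (sumF-cong n (λ x → cong (λ b → ind b * countB n (λ y → S y ∧ (adj G x y ∧ offB j (ψ x) (ψ y)))) (h x))) (sumF-0 n)
    c0 : lines j S ≡ 0
    c0 = trans (countB-cong n (λ x → cong (λ b → b ∧ not (anyB n (λ y → S y ∧ (ltF y x ∧ offB j (ψ y) (ψ x))))) (h x))) (trans (countB-sum n _) (sumF-0 n))
    s0 : countB n S ≡ 0
    s0 = trans (countB-cong n h) (trans (countB-sum n _) (sumF-0 n))
  ... | inj₁ (x0 , s0 , mn) = begin
      degAlong j S + 2 * c * lines j S ≡⟨ cong₂ _+_ degAlong-split (cong (2 * c *_) lines-split) ⟩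
      (degIn G L + degAlong j Rest) + 2 * c * suc (lines j Rest) ≡⟨ regroup (degIn G L) (degAlong j Rest) (2 * c) (lines j Rest) ⟩
      (degIn G L + 2 * c) + (degAlong j Rest + 2 * c * lines j Rest) ≤⟨ +-mono-≤ (line-edges j L x0 x0∈L L-on-line) rest-bound ⟩
      2 * c * countB n L + 2 * c * countB n Rest ≡⟨ sym (trans (cong (2 * c *_) size-split) (*-distribˡ-+ (2 * c) _ _)) ⟩
      2 * c * countB n S ∎
    where
    open PeelLine j S x0 s0 mn
    open ≤-Reasoning
    regroup : ∀ a b t u → (a + b) + t * suc u ≡ (a + t) + (b + t * u)
    regroup a b t u = solve (a ∷ b ∷ t ∷ u ∷ [])
    rest-bound : degAlong j Rest + 2 * c * lines j Rest ≤ 2 * c * countB n Rest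
    rest-bound = degAlong-bound k j Rest (≤-trans (subst (countB n Rest <_) (sym size-split) (+-monoˡ-≤ (countB n Rest) (countB-pos n L x0 x0∈L))) (≤-pred lt))


-- A rooted spanning tree of K, presented through a bijective ranking rk of the vertices
-- by 0 … |K|−1 in which every non-root rank i ≥ 1 has an adjacent parent of smaller rank.
record RankedTree (K : Graph) : Set where
  field
    rk : Fin (size K) → ℕ
    rk< : ∀ v → rk v < size K
    rk-inj : ∀ u v → rk u ≡ rk v → u ≡ v
    ur : (i : ℕ) → i < size K → Fin (size K)
    rk-ur : ∀ i h → rk (ur i h) ≡ i
    par : ℕ → ℕ
    par< : ∀ i → 1 ≤ i → par i < i
    padj : ∀ i (h : i < size K) (h1 : 1 ≤ i) → adj K (ur (par i) (<-trans (par< i h1) h)) (ur i h) ≡ true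

-- Every connected nonempty graph has a ranked spanning tree: grow it one vertex at a
-- time, attaching a vertex adjacent to the part already ranked (it exists by connectivity).
module GrowTree (K : Graph) (N' : ℕ) (sz : size K ≡ suc N') (conn : Connected K) where
  N = size K

  record PartialTree (k : ℕ) : Set where
    field
      ord : ℕ → Fin N
      oinj : ∀ i i' → i < k → i' < k → ord i ≡ ord i' → i ≡ i'
      opar : ℕ → ℕ
      opar< : ∀ i → 1 ≤ i → i < k → opar i < i
      oadj : ∀ i → 1 ≤ i → i < k → adj K (ord (opar i)) (ord i) ≡ true
  open PartialTree

  z0 : Fin N
  z0 = subst Fin (sym sz) zero

  rootOnly : PartialTree 1
  rootOnly = record { ord = λ _ → z0 ; oinj = λ { zero zero _ _ _ → refl ; (suc i) _ (s≤s ()) _ _ ; zero (suc i) _ (s≤s ()) _ }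
                ; opar = λ _ → 0 ; opar< = λ { zero () _ ; (suc i) _ (s≤s ()) } ; oadj = λ { zero () _ ; (suc i) _ (s≤s ()) } }

  inSet : ∀ {k} → PartialTree k → Fin N → Bool
  inSet {k} o z = anyB k (λ i → eqF (ord o (toℕ i)) z)

  inSet-sound : ∀ {k} (o : PartialTree k) z → inSet o z ≡ true → Σ (Fin k) λ i → ord o (toℕ i) ≡ z
  inSet-sound {k} o z e with anyB-sound k _ e
  ... | i , h = i , eqF-≡ h

  inSet-complete : ∀ {k} (o : PartialTree k) i → i < k → inSet o (ord o i) ≡ true
  inSet-complete {k} o i lt = anyB-complete k _ (fromℕ< lt)
    (subst (λ w → eqF (ord o w) (ord o i) ≡ true) (sym (toℕ-fromℕ< lt)) (eqF-refl (ord o i)))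

  attach : ∀ {k} (o : PartialTree k) (y : Fin N) (p : ℕ) → p < k → adj K (ord o p) y ≡ true → inSet o y ≡ false → PartialTree (suc k)
  attach {k} o y p pk a ny = record { ord = ord' ; oinj = inj' ; opar = par' ; opar< = par<' ; oadj = adj' }
    where
    ord' : ℕ → Fin N
    ord' i = if eqN i k then y else ord o i
    par' : ℕ → ℕ
    par' i = if eqN i k then p else opar o i
    ord'-old : ∀ i → i < k → ord' i ≡ ord o i
    ord'-old i lt rewrite eqN-≢ {i} {k} (λ e → <-irrefl e lt) = refl
    ord'-new : ord' k ≡ y
    ord'-new rewrite eqN-refl k = refl
    par'-old : ∀ i → i < k → par' i ≡ opar o i
    par'-old i lt rewrite eqN-≢ {i} {k} (λ e → <-irrefl e lt) = refl
    par'-new : par' k ≡ p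
    par'-new rewrite eqN-refl k = refl
    notin : ∀ i → i < k → ¬ ord o i ≡ y
    notin i lt e = t≢f (trans (sym (subst (λ w → inSet o w ≡ true) e (inSet-complete o i lt))) ny)
    cases : ∀ i → i < suc k → i < k ⊎ i ≡ k
    cases i lt with m≤n⇒m<n∨m≡n (≤-pred lt)
    ... | inj₁ l = inj₁ l
    ... | inj₂ e = inj₂ e
    inj' : ∀ i i' → i < suc k → i' < suc k → ord' i ≡ ord' i' → i ≡ i'
    inj' i i' l l' e with cases i l | cases i' l'
    ... | inj₁ a | inj₁ b = oinj o i i' a b (trans (sym (ord'-old i a)) (trans e (ord'-old i' b)))
    ... | inj₂ refl | inj₂ refl = refl
    ... | inj₁ a | inj₂ refl = ⊥-elim (notin i a (trans (sym (ord'-old i a)) (trans e ord'-new)))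
    ... | inj₂ refl | inj₁ b = ⊥-elim (notin i' b (trans (sym (ord'-old i' b)) (trans (sym e) ord'-new)))
    par<' : ∀ i → 1 ≤ i → i < suc k → par' i < i
    par<' i h1 l with cases i l
    ... | inj₁ a = subst (_< i) (sym (par'-old i a)) (opar< o i h1 a)
    ... | inj₂ refl = subst (_< i) (sym par'-new) pk
    adj' : ∀ i → 1 ≤ i → i < suc k → adj K (ord' (par' i)) (ord' i) ≡ true
    adj' i h1 l with cases i l
    ... | inj₁ a rewrite par'-old i a | ord'-old i a | ord'-old (opar o i) (<-trans (opar< o i h1 a) a) = oadj o i h1 a
    ... | inj₂ refl rewrite par'-new | ord'-new | ord'-old p pk = a

  escape : ∀ {k} (o : PartialTree k) {x z} → Reach K (λ _ → Fin 1) x z → inSet o x ≡ true → inSet o z ≡ false →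
           Σ (Fin N) λ a → Σ (Fin N) λ b → inSet o a ≡ true × inSet o b ≡ false × adj K a b ≡ true
  escape o here ix iz = ⊥-elim (t≢f (trans (sym ix) iz))
  escape o (step {y = y} a _ r) ix iz with inSet o y in iy
  ... | false = _ , y , ix , iy , a
  ... | true = escape o r iy iz

  grow : ∀ {k} → 1 ≤ k → k < N → PartialTree k → PartialTree (suc k)
  grow {k} k1 kN o with search N (λ z → not (inSet o z))
  ... | inj₂ h = ⊥-elim (<⇒≱ kN (injective⇒≤ {f = idx} idx-inj))
    where
    allin : ∀ z → inSet o z ≡ true
    allin z with inSet o z in e
    ... | true = refl
    ... | false = ⊥-elim (t≢f (trans (sym (cong not e)) (h z)))
    idx : Fin N → Fin k
    idx z = proj₁ (inSet-sound o z (allin z))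
    idx-inj : ∀ {a b} → idx a ≡ idx b → a ≡ b
    idx-inj {a} {b} e = trans (sym (proj₂ (inSet-sound o a (allin a)))) (trans (cong (λ i → ord o (toℕ i)) e) (proj₂ (inSet-sound o b (allin b))))
  ... | inj₁ (y0 , hy0) with escape o (conn (ord o 0) y0) (inSet-complete o 0 k1) (not-t hy0)
  ...   | a , b , ia , ib , ab with inSet-sound o a ia
  ...     | i , oi = attach o b (toℕ i) (toℕ<n i) (subst (λ w → adj K w b ≡ true) (sym oi) ab) ib

  growAll : ∀ t k → 1 ≤ k → k + t ≡ N → PartialTree k → PartialTree N
  growAll zero k k1 e o = subst PartialTree (trans (sym (+-identityʳ k)) e) o
  growAll (suc t) k k1 e o = growAll t (suc k) (s≤s z≤n) (trans (sym (+-suc k t)) e)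
                            (grow k1 (subst (k <_) e (≤-trans (s≤s (m≤m+n k t)) (≤-reflexive (sym (+-suc k t))))) o)

  complete : PartialTree N
  complete = growAll N' 1 (s≤s z≤n) (sym sz) rootOnly

  -- the completed tree ranks every vertex: otherwise its N ranked vertices together with
  -- an unranked one would give N + 1 distinct vertices
  complete-covers : ∀ z → inSet complete z ≡ true
  complete-covers z with inSet complete z in e
  ... | true = refl
  ... | false = ⊥-elim (<-irrefl refl (injective⇒≤ {f = f} f-inj))
    where
    f : Fin (suc N) → Fin N
    f i = if toℕ i <ᵇ N then ord complete (toℕ i) else z
    notin : ∀ i → i < N → ¬ ord complete i ≡ z
    notin i lt q = t≢f (trans (sym (subst (λ w → inSet complete w ≡ true) q (inSet-complete complete i lt))) e)
    rank-N : ∀ (a : Fin (suc N)) → (toℕ a <ᵇ N) ≡ false → toℕ a ≡ N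
    rank-N a ea = ≤-antisym (≤-pred (toℕ<n a)) (ltb-false _ _ ea)
    f-inj : ∀ {a b} → f a ≡ f b → a ≡ b
    f-inj {a} {b} fab with toℕ a <ᵇ N in ea | toℕ b <ᵇ N in eb
    ... | true | true = toℕ-injective (oinj complete _ _ (ltb-true _ _ ea) (ltb-true _ _ eb) fab)
    ... | true | false = ⊥-elim (notin (toℕ a) (ltb-true _ _ ea) fab)
    ... | false | true = ⊥-elim (notin (toℕ b) (ltb-true _ _ eb) (sym fab))
    ... | false | false = toℕ-injective (trans (rank-N a ea) (sym (rank-N b eb)))

  rankedTree : RankedTree K
  rankedTree = record { rk = rk ; rk< = λ v → toℕ<n _ ; rk-inj = rkinj ; ur = λ i _ → ord complete i ; rk-ur = rkur
                ; par = par ; par< = par<' ; padj = padj' }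
    where
    rk : Fin N → ℕ
    rk z = toℕ (proj₁ (inSet-sound complete z (complete-covers z)))
    ord-rk : ∀ z → ord complete (rk z) ≡ z
    ord-rk z = proj₂ (inSet-sound complete z (complete-covers z))
    rkinj : ∀ u v → rk u ≡ rk v → u ≡ v
    rkinj u v e = trans (sym (ord-rk u)) (trans (cong (ord complete) e) (ord-rk v))
    rkur : ∀ i (h : i < N) → rk (ord complete i) ≡ i
    rkur i h = oinj complete _ _ (toℕ<n _) h (ord-rk (ord complete i))
    par : ℕ → ℕ
    par i = if i <ᵇ N then opar complete i else 0
    par-eq : ∀ i → i < N → par i ≡ opar complete i
    par-eq i h rewrite ltb-intro i N h = refl
    par<' : ∀ i → 1 ≤ i → par i < i
    par<' i h1 with i <ᵇ N in e
    ... | true = opar< complete i h1 (ltb-true _ _ e)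
    ... | false = h1
    padj' : ∀ i (h : i < N) (h1 : 1 ≤ i) → adj K (ord complete (par i)) (ord complete i) ≡ true
    padj' i h h1 rewrite par-eq i h = oadj complete i h1 h

spanningTree : (K : Graph) → Connected K → RankedTree K
spanningTree K conn = by-size (size K) refl
  where
  by-size : ∀ s → size K ≡ s → RankedTree K
  by-size zero e = record { rk = λ v → ⊥-elim (fin0 v) ; rk< = λ v → ⊥-elim (fin0 v) ; rk-inj = λ u → ⊥-elim (fin0 u)
                    ; ur = λ i h → ⊥-elim (n<0 h) ; rk-ur = λ i h → ⊥-elim (n<0 h) ; par = λ _ → 0
                    ; par< = λ i h1 → h1 ; padj = λ i h → ⊥-elim (n<0 h) }
    where fin0 : Fin (size K) → ⊥
          fin0 v with subst Fin e v
          ... | ()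
          n<0 : ∀ {i} → i < size K → ⊥
          n<0 {i} h with subst (i <_) e h
          ... | ()
  by-size (suc N') e = GrowTree.rankedTree K N' e conn

-- Connectivity of parts cut from a ranked tree: if a set of ranks P contains a target
-- rank and is closed under taking parents away from the target, the corresponding
-- vertices induce a connected subgraph (walk up the tree to the target).
module TreeWalks (K : Graph) (T : RankedTree K) where
  open RankedTree T

  ur-rk : ∀ v → ur (rk v) (rk< v) ≡ v
  ur-rk v = rk-inj _ _ (rk-ur (rk v) (rk< v))

  ur-irr : ∀ i (h h' : i < size K) → ur i h ≡ ur i h'
  ur-irr i h h' = rk-inj _ _ (trans (rk-ur i h) (sym (rk-ur i h')))

  walk-to-target : (P : ℕ → Bool) (tg : ℕ) (ht : tg < size K) →
    (∀ r → P r ≡ true → ¬ r ≡ tg → 1 ≤ r × P (par r) ≡ true) →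
    ∀ f v → rk v < f → P (rk v) ≡ true → Reach K (λ z → P (rk z) ≡ true) v (ur tg ht)
  walk-to-target P tg ht h (suc f) v lt pv with rk v Data.Nat.≟ tg
  ... | yes e = subst (λ w → Reach K (λ z → P (rk z) ≡ true) v w) (trans (sym (ur-rk v)) (cong₂' e)) here
    where cong₂' : rk v ≡ tg → ur (rk v) (rk< v) ≡ ur tg ht
          cong₂' refl = ur-irr _ _ _
  ... | no ne with h (rk v) pv ne
  ...   | r1 , pp = step a' (subst (λ i → P i ≡ true) (sym (rk-ur (par (rk v)) wlt)) pp)
                      (walk-to-target P tg ht h f w (subst (_< f) (sym (rk-ur (par (rk v)) wlt)) (≤-trans (par< (rk v) r1) (≤-pred lt)))
                        (subst (λ i → P i ≡ true) (sym (rk-ur (par (rk v)) wlt)) pp))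
    where
    wlt : par (rk v) < size K
    wlt = <-trans (par< (rk v) r1) (rk< v)
    w = ur (par (rk v)) wlt
    a0 : adj K (ur (par (rk v)) (<-trans (par< (rk v) r1) (rk< v))) (ur (rk v) (rk< v)) ≡ true
    a0 = padj (rk v) (rk< v) r1
    a' : adj K v w ≡ true
    a' = trans (Graph.sym K v w) (subst (λ z → adj K w z ≡ true) (ur-rk v) a0)

  ranks-connected : (P : ℕ → Bool) (tg : ℕ) (ht : tg < size K) → P tg ≡ true →
    (∀ r → P r ≡ true → ¬ r ≡ tg → 1 ≤ r × P (par r) ≡ true) →
    ConnectedSet K (λ z → P (rk z) ≡ true)
  ranks-connected P tg ht ptg h x y px py = Reach-app (walk-to-target P tg ht h (suc (rk x)) x ≤-refl px)
     (Reach-rev (walk-to-target P tg ht h (suc (rk y)) y ≤-refl py) py)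

-- The two sides of a cut direction as the vertex set Fin 2 of a factor of a
-- minor-subproduct (a direction outside J is a single vertex)
toFin : ∀ b → Bool → Fin (if b then 2 else 1)
toFin true s = if s then suc zero else zero
toFin false s = zero

fromFin : ∀ b → Fin (if b then 2 else 1) → Bool
fromFin true zero = false
fromFin true (suc _) = true
fromFin false _ = false

toFin-fromFin : ∀ b (a : Fin (if b then 2 else 1)) s → (b ≡ true → s ≡ fromFin b a) → toFin b s ≡ a
toFin-fromFin true zero s h rewrite h refl = refl
toFin-fromFin true (suc zero) s h rewrite h refl = refl
toFin-fromFin false zero s h = refl

nontrivial-side : ∀ b → (2 ≤ᵇ (if b then 2 else 1)) ≡ b
nontrivial-side true = refl
nontrivial-side false = refl

-- Turning cuts into minor-subproducts.  With ranks from spanning trees of the connected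
-- factors, a valid cut (J, cut) shattered by S gives a minor-subproduct with two parts in
-- each direction of J (the subtree of cut j and the rest, both connected), one part
-- elsewhere, and no edges needed; it is shattered by G and has |J| non-trivial factors.
module CutsToMinors (G : Graph) (m : ℕ) (Gs : Fin m → Graph) (φ : Fin (size G) → ProdV Gs)
          (T : (j : Fin m) → RankedTree (Gs j)) (connG : ∀ j → Connected (Gs j)) where
  par : Fin m → ℕ → ℕ
  par j = RankedTree.par (T j)
  par< : ∀ j i → 1 ≤ i → par j i < i
  par< j = RankedTree.par< (T j)
  open Anc m par par<
  open Shifting m (size G) par par<

  ψ : Fin (size G) → Fin m → ℕ
  ψ x j = RankedTree.rk (T j) (φ x j)

  nb : Fin m → ℕ
  nb j = size (Gs j)

  side : (j : Fin m) → ℕ → Fin (size (Gs j)) → Bool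
  side j c v = anc j c (RankedTree.rk (T j) v)

  open TreeWalks

  -- the subtree of c is connected: walk up to c
  subtree-connected : ∀ j c → c < size (Gs j) → ConnectedSet (Gs j) (λ x → side j c x ≡ true)
  subtree-connected j c c<N = ranks-connected (Gs j) (T j) (anc j c) c c<N (anc-self j c) up
    where
    up : ∀ r → anc j c r ≡ true → ¬ r ≡ c → 1 ≤ r × anc j c (par j r) ≡ true
    up zero q ne = ⊥-elim (ne (sym (n<1⇒n≡0 (root-only q))))
      where root-only : eqN 0 c ∨ (not (eqN 0 0) ∧ ancF j c 0 (par j 0)) ≡ true → c < 1
            root-only q' with eqN 0 c in e0
            ... | true = subst (_< 1) (eqN-≡ e0) (s≤s z≤n)
            ... | false = ⊥-elim (t≢f (sym q'))
    up (suc r) q ne = s≤s z≤n , trans (sym (anc-step j c (suc r) (s≤s z≤n) ne)) q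

  -- the complement of the subtree of a non-root c is connected: walk up to the root
  complement-connected : ∀ j c → 1 ≤ c → c < size (Gs j) → ConnectedSet (Gs j) (λ x → side j c x ≡ false)
  complement-connected j c 1≤c c<N x y px py =
    Reach-mono (λ z q → not-t q)
      (ranks-connected (Gs j) (T j) (λ r → not (anc j c r)) 0 (<-trans 1≤c c<N)
         (not-f (anc-below j c 0 1≤c)) up x y (not-f px) (not-f py))
    where
    up : ∀ r → not (anc j c r) ≡ true → ¬ r ≡ 0 → 1 ≤ r × not (anc j c (par j r)) ≡ true
    up zero _ ne = ⊥-elim (ne refl)
    up (suc r) q ne = s≤s z≤n , subst (λ b → not b ≡ true) (anc-step j c (suc r) (s≤s z≤n) r≢c) q
      where r≢c : ¬ suc r ≡ c
            r≢c e' = t≢f (trans (sym (subst (λ i → anc j c i ≡ true) (sym e') (anc-self j c))) (not-t q))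

  cut⇒minor-subproduct : ∀ J cut S → ValidCut nb J cut → CutShattered S ψ J cut →
          Σ (MinorSubproduct Gs) λ M → Shattered G φ M × nontrivial M ≡ countB m J
  cut⇒minor-subproduct J cut S val sh = M , shat , ntr
    where
    parts : Fin m → ℕ
    parts j = if J j then 2 else 1
    π' : (j : Fin m) → Fin (size (Gs j)) → Fin (parts j)
    π' j v = toFin (J j) (side j (cut j) v)
    x0 : Fin (size G)
    x0 = proj₁ (sh (λ _ → false))
    surj : ∀ j b (a : Fin (if b then 2 else 1)) → J j ≡ b → ∃ λ x → toFin b (side j (cut j) x) ≡ a
    surj j true zero e = RankedTree.ur (T j) 0 ht , subst (λ s → toFin true s ≡ zero) (sym root-outside) refl
      where
      ht : 0 < size (Gs j)
      ht = <-trans (proj₁ (val j e)) (proj₂ (val j e))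
      root-outside : side j (cut j) (RankedTree.ur (T j) 0 ht) ≡ false
      root-outside = trans (cong (anc j (cut j)) (RankedTree.rk-ur (T j) 0 ht)) (anc-below j (cut j) 0 (proj₁ (val j e)))
    surj j true (suc zero) e = RankedTree.ur (T j) (cut j) (proj₂ (val j e)) ,
      subst (λ s → toFin true s ≡ suc zero) (sym (trans (cong (anc j (cut j)) (RankedTree.rk-ur (T j) _ _)) (anc-self j (cut j)))) refl
    surj j false zero e = φ x0 j , refl
    conn : ∀ j b (a : Fin (if b then 2 else 1)) → J j ≡ b → ConnectedSet (Gs j) (λ x → toFin b (side j (cut j) x) ≡ a)
    conn j false zero e x y _ _ = Reach-mono (λ _ _ → refl) (connG j x y)
    conn j true zero e x y px py =
      Reach-mono (λ z q → tf0 _ q) (complement-connected j (cut j) (proj₁ (val j e)) (proj₂ (val j e)) x y (ft0 _ px) (ft0 _ py))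
      where
      ft0 : ∀ s → toFin true s ≡ zero → s ≡ false
      ft0 false _ = refl
      tf0 : ∀ s → s ≡ false → toFin true s ≡ zero
      tf0 false _ = refl
    conn j true (suc zero) e x y px py =
      Reach-mono (λ z q → tf1 _ q) (subtree-connected j (cut j) (proj₂ (val j e)) x y (ft1 _ px) (ft1 _ py))
      where
      ft1 : ∀ s → toFin true s ≡ suc zero → s ≡ true
      ft1 true _ = refl
      tf1 : ∀ s → s ≡ true → toFin true s ≡ suc zero
      tf1 true _ = refl
    M : MinorSubproduct Gs
    M = record
      { t = parts ; π = π'
      ; π-surj = λ j a → surj j (J j) a refl
      ; π-conn = λ j a → conn j (J j) a refl
      ; Madj = λ _ _ _ → false ; Madj-sym = λ _ _ _ → refl ; Madj-irr = λ _ _ → refl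
      ; Madj-real = λ j a b () }
    shat : Shattered G φ M
    shat l with sh (λ j → fromFin (J j) (l j))
    ... | x , sx , h = x , λ j → toFin-fromFin (J j) (l j) (side j (cut j) (φ x j)) (h j)
    ntr : nontrivial M ≡ countB m J
    ntr = countB-cong m (λ j → nontrivial-side (J j))

K2 : Graph
K2 = record { size = 2 ; adj = a ; sym = s ; irrefl = i }
  where
  a : Fin 2 → Fin 2 → Bool
  a zero zero = false
  a zero (suc zero) = true
  a (suc zero) zero = true
  a (suc zero) (suc zero) = false
  s : ∀ x y → a x y ≡ a y x
  s zero zero = refl
  s zero (suc zero) = refl
  s (suc zero) zero = refl
  s (suc zero) (suc zero) = refl
  i : ∀ x → a x x ≡ false
  i zero = refl
  i (suc zero) = refl

-- if μ = p/q < 1, H-minor-free graphs have no edges: an edge would give K_2, of density 1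
minor-free-edgeless : ∀ (H K : Graph) → ¬ Minor H K → ∀ p q → (∀ F → ¬ Minor H F → degSum F * q ≤ p * size F) → p < q →
         ∀ x y → adj K x y ≡ true → ⊥
minor-free-edgeless H K free p q hF pq x y axy = <⇒≱ pq (*-cancelʳ-≤ q p 2 (subst (_≤ p * 2) (*-comm 2 q) (hF K2 K2-free)))
  where
  ι : Fin 2 → Fin (size K)
  ι zero = x
  ι (suc zero) = y
  x≢y : ¬ x ≡ y
  x≢y = adj-ne K axy
  ι-inj : ∀ a b → ι a ≡ ι b → a ≡ b
  ι-inj zero zero _ = refl
  ι-inj zero (suc zero) e = ⊥-elim (x≢y e)
  ι-inj (suc zero) zero e = ⊥-elim (x≢y (sym e))
  ι-inj (suc zero) (suc zero) _ = refl
  ι-hom : ∀ a b → adj K2 a b ≡ true → adj K (ι a) (ι b) ≡ true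
  ι-hom zero (suc zero) _ = axy
  ι-hom (suc zero) zero _ = trans (Graph.sym K y x) axy
  ι-hom zero zero ()
  ι-hom (suc zero) (suc zero) ()
  K2-free : ¬ Minor H K2
  K2-free mn = free (minor-transfer H K2 K ι ι-inj ι-hom mn)

edgeless-orientation : (G : Graph) → (∀ x y → adj G x y ≡ true → ⊥) →
  Σ (Orientation G) λ o → ∀ x → outdeg o x ≡ 0
edgeless-orientation G noE =
  record { out = λ _ _ → false ; out-edge = λ x y () ; orient = λ x y a → ⊥-elim (noE x y a) } ,
  λ x → countB-false (size G)

below-next-multiple : ∀ p q .{{_ : NonZero q}} → p < suc (p / q) * q
below-next-multiple p q = subst (_< suc (p / q) * q) (sym (m≡m%n+[m/n]*n p q)) (+-monoˡ-< ((p / q) * q) (m%n<n p q))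

-- The density bound.  With c ≥ 1 and p < (c + 1)q, every vertex set S of G spans at most
-- d·c·|S| edges: by the fibre bound in every direction,
--   degIn G S + 2c·Σ_j lines_j(S) ≤ Σ_j (degAlong_j S + 2c·lines_j(S)) ≤ 2c·m·|S|,
-- and by the shifting inequality  2c·m·|S| ≤ 2c·d·|S| + 2c·Σ_j lines_j(S).
module Density (H : Graph) (p q : ℕ) (hF : ∀ F → ¬ Minor H F → degSum F * q ≤ p * size F)
  (m : ℕ) (Gs : Fin m → Graph) (connG : ∀ i → Connected (Gs i)) (freeG : ∀ i → ¬ Minor H (Gs i))
  (G : Graph) (φ : Fin (size G) → ProdV Gs) (sub : IsSubgraphVia Gs G φ) (d : ℕ)
  (maximal : ∀ (M : MinorSubproduct Gs) → Shattered G φ M → nontrivial M ≤ d)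
  (c : ℕ) (c1 : 1 ≤ c) (pq : p < suc c * q) where

  n = size G
  trees : (j : Fin m) → RankedTree (Gs j)
  trees j = spanningTree (Gs j) (connG j)
  open CutsToMinors G m Gs φ trees connG using (ψ; nb; par; par<; cut⇒minor-subproduct)
  open Shifting m n par par< using (DimAtMost; lines)
  open ShiftingBound m n par par< using (shifting-bound)
  open Pts m using (offB; offB-complete)

  ψ-determines : ∀ x y i → ψ x i ≡ ψ y i → φ x i ≡ φ y i
  ψ-determines x y i e = RankedTree.rk-inj (trees i) _ _ e

  open LineBound H G m Gs φ sub ψ ψ-determines freeG p q c hF c1 pq using (degAlong; degAlong-bound)

  -- every subfamily of G has dimension at most d, since shattered cuts are minor-subproducts
  cut-dim : ∀ S → DimAtMost S ψ nb d
  cut-dim S J cut val sh with cut⇒minor-subproduct J cut S val sh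
  ... | M , shat , ntr = subst (_≤ d) ntr (maximal M shat)

  shifting : ∀ S → m * countB n S ≤ d * countB n S + sumF m (λ j → lines j S ψ)
  shifting S = shifting-bound (suc (countB n S + sumF m nb)) S ψ nb d ≤-refl
                 (λ x _ j → RankedTree.rk< (trees j) (φ x j))
                 (λ x y _ _ e → proj₁ sub x y (λ i → ψ-determines x y i (e i)))
                 (cut-dim S)

  -- every edge of the product runs along some direction
  edges-by-direction : ∀ S → degIn G S ≤ sumF m (λ j → degAlong j S)
  edges-by-direction S = subst (degIn G S ≤_) (sym (sumF-swap m n _)) (sumF-mono n per-vertex)
    where
    per-edge : ∀ x y → ind (S y ∧ adj G x y) ≤ sumF m (λ j → ind (S y ∧ (adj G x y ∧ offB j (ψ x) (ψ y))))
    per-edge x y with S y ∧ adj G x y in e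
    ... | false = z≤n
    ... | true with ∧-split {S y} e
    ...   | sy , axy with proj₂ sub x y axy
    ...     | j , off , _ = ≤-trans (≤-reflexive (cong ind (sym (∧-intro sy (∧-intro axy along-j))))) (sumF-≥ m _ j)
      where along-j : offB j (ψ x) (ψ y) ≡ true
            along-j = offB-complete j _ _ (λ i ne → cong (RankedTree.rk (trees i)) (off i ne))
    per-vertex : ∀ x → ind (S x) * countB n (λ y → S y ∧ adj G x y) ≤
               sumF m (λ j → ind (S x) * countB n (λ y → S y ∧ (adj G x y ∧ offB j (ψ x) (ψ y))))
    per-vertex x = subst (ind (S x) * countB n (λ y → S y ∧ adj G x y) ≤_) (sym (sumF-* m (ind (S x)) _))
             (*-monoʳ-≤ (ind (S x)) (subst₂ _≤_ (sym (countB-sum n _))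
               (trans (sumF-swap n m _) (sumF-cong m (λ j → sym (countB-sum n _)))) (sumF-mono n (per-edge x))))

  density-bound : ∀ S → degIn G S ≤ 2 * ((d * c) * countB n S)
  density-bound S = ≤-trans (edges-by-direction S) (≤-trans along≤ (≤-reflexive (regroup c d s)))
    where
    s = countB n S
    along = sumF m (λ j → degAlong j S)
    lns = sumF m (λ j → lines j S ψ)
    regroup : ∀ c d s → 2 * c * (d * s) ≡ 2 * ((d * c) * s)
    regroup c d s = solve (c ∷ d ∷ s ∷ [])
    commute : ∀ m c s → 2 * c * (m * s) ≡ m * (2 * c * s)
    commute m c s = solve (m ∷ c ∷ s ∷ [])
    fibres : along + 2 * c * lns ≤ m * (2 * c * s)
    fibres = subst₂ _≤_ (trans (sumF-+ m _ _) (cong (along +_) (sumF-* m (2 * c) _))) (sumF-const m _)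
            (sumF-mono m (λ j → degAlong-bound (suc s) j S ≤-refl))
    combined : along + 2 * c * lns ≤ 2 * c * (d * s) + 2 * c * lns
    combined = ≤-trans fibres (subst₂ _≤_ (commute m c s) (*-distribˡ-+ (2 * c) (d * s) lns) (*-monoʳ-≤ (2 * c) (shifting S)))
    along≤ : along ≤ 2 * c * (d * s)
    along≤ = +-cancelʳ-≤ (2 * c * lns) along (2 * c * (d * s)) combined

-- With μ = p/q and c = ⌊μ⌋: if c = 0 the graph has no edges; otherwise the density bound
-- and Hakimi's theorem give outdegrees at most d·c, and d·c·q ≤ d·p.
corollary4p4 : (H : Graph) (p q : ℕ) → 1 ≤ q →
    (∀ (F : Graph) → ¬ Minor H F → degSum F * q ≤ p * size F) →
    (m : ℕ) (Gs : Fin m → Graph) →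
    (∀ i → Connected (Gs i)) → (∀ i → ¬ Minor H (Gs i)) →
    (G : Graph) (φ : Fin (size G) → ProdV Gs) → IsSubgraphVia Gs G φ →
    (d : ℕ) → IsVcdStar Gs G φ d →
    Σ (Orientation G) λ o → ∀ x → outdeg o x * q ≤ d * p
corollary4p4 H p q@(suc _) _ hF m Gs connG freeG G φ sub d (_ , maximal) =
  orientWith (p / q) (below-next-multiple p q) (m/n*n≤m p q)
  where
  orientWith : ∀ c → p < suc c * q → c * q ≤ p → Σ (Orientation G) λ o → ∀ x → outdeg o x * q ≤ d * p
  orientWith zero p<q _ with edgeless-orientation G no-edges
    where
    no-edges : ∀ x y → adj G x y ≡ true → ⊥
    no-edges x y a with proj₂ sub x y a
    ... | j , _ , aj = minor-free-edgeless H (Gs j) (freeG j) p q hF (subst (p <_) (+-identityʳ q) p<q) _ _ aj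
  ... | o , zero-out = o , λ x → subst (λ k → k * q ≤ d * p) (sym (zero-out x)) z≤n
  orientWith (suc c) pq cq≤p with hakimi G (d * suc c) (Density.density-bound H p q hF m Gs connG freeG G φ sub d maximal (suc c) (s≤s z≤n) pq)
  ... | o , bounded = o , λ x → ≤-trans (*-monoˡ-≤ q (bounded x))
                                  (subst (_≤ d * p) (sym (*-assoc d (suc c) q)) (*-monoʳ-≤ d cq≤p))
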